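{- Let $(T,I,J)$ be a gluing tree, let $j\in J$ with $N_T(j)=\{i,k\}$, and let $(T^i,I^i,J^i)$, $(T^k,I^k,J^k)$ be the interventional parting of $T$ at $j$. Then, identifying $\mathrm{CIM}_T^{I,J}$ with its image after deleting the coordinates $x_{ijk}$ and $x_{ijj'k}$ (which vanish on it), $\mathrm{CIM}_T^{I,J}$ is the intersection of the product polytope $\mathrm{CIM}_{T^i}^{I^i,J^i}\times\mathrm{CIM}_{T^k}^{I^k,J^k}$ with the hyperplane $x_{ijj'}+x_{jj'k}=1$.
   Context: A gluing tree $(T,I,J)$ is a tree $T$ with disjoint node sets $I,J$ such that no two nodes of $I\cup J$ are adjacent, every node of $I$ is a leaf of $T$ and every node of $J$ has degree two in $T$. For a DAG $\mathcal{T}$ with skeleton $T$, $\mathcal{T}^{I\cup J}$ is obtained by adding a new node $v'$ and an edge $v'\to v$ for each $v\in I\cup J$. For a DAG $\mathcal{D}$ on a finite set $V$ and $A\subseteq V$, $c_{\mathcal{D}}(A)=1$ if some $a\in A$ has every $b\in A\setminus\{a\}$ as a parent in $\mathcal{D}$, and $0$ otherwise. $\mathrm{CIM}_T^{I,J}=\mathrm{conv}\{c_{\mathcal{T}^{I\cup J}}:\mathcal{T}\text{ a DAG with skeleton }T\text{ such that for all }j\in J\text{ with }N_T(j)=\{i,k\},\ i\to j\to k\text{ or }i\leftarrow j\leftarrow k\text{ in }\mathcal{T}\}$, regarded in the coordinates $x_A$ with $A$ the vertex set of a star subgraph (a vertex with at least two of its neighbours) of $T$ with the edges $v'\to v$ added;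 the remaining coordinates are constant on the polytope. The interventional parting at $j$: $T^i$ is the connected component of $T$ minus the edge $j-k$ containing $i$, $T^k$ is the connected component of $T$ minus the edge $i-j$ containing $k$, and for $\ell\in\{i,k\}$, $I^\ell=(I\cup\{j\})\cap V(T^\ell)$, $J^\ell=(J\setminus\{j\})\cap V(T^\ell)$. The coordinates of $\mathrm{CIM}_T^{I,J}$ other than $x_{ijk},x_{ijj'k}$ are exactly the disjoint union of the coordinates of $\mathrm{CIM}_{T^i}^{I^i,J^i}$ and of $\mathrm{CIM}_{T^k}^{I^k,J^k}$ (the coordinate $x_{ijj'}$ belongs to the former and $x_{jj'k}$ to the latter).
   Formalization: The polytopes $\mathrm{CIM}_T^{I,J}$, $\mathrm{CIM}_{T^i}^{I^i,J^i}$, $\mathrm{CIM}_{T^k}^{I^k,J^k}$ and the hyperplane are taken over ℚ, with rational coordinates and rational convex weights. -}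

module Defs where

open import Data.Nat using (ℕ; zero; suc; _≤_)
import Data.Nat as ℕ
open import Data.Bool using (Bool; true; false; _∧_; _∨_; not; if_then_else_)
open import Data.Fin using (Fin; zero; suc; _≟_)
open import Data.Fin.Subset using (Subset; _∈_; _∉_; _⊆_; ⁅_⁆; _∪_; _∩_; ∁; ∣_∣)
open import Data.Vec using (lookup; tabulate)
open import Data.List using (List; []; _∷_; _++_; [_]; length)
open import Data.List.Relation.Unary.All using (All)
open import Data.List.Relation.Unary.Unique.Propositional using (Unique)
open import Data.List.Relation.Unary.Linked using (Linked)
open import Data.Product using (Σ; _×_; _,_; proj₁; proj₂)
open import Data.Sum using (_⊎_; inj₁; inj₂)
open import Data.Empty using (⊥)
open import Data.Unit using (⊤)
open import Data.Rational using (ℚ; 0ℚ; 1ℚ; _+_; _*_) renaming (_≤_ to _≤ℚ_)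
open import Relation.Nullary using (¬_; ⌊_⌋)
open import Relation.Binary.PropositionalEquality using (_≡_; _≢_)

-- Graphs on an ambient vertex type Fin n.
-- A graph is a vertex set U : Subset n together with a Bool-valued
-- adjacency relation Adj (intended symmetric, irreflexive, inside U).

Adjacency : ℕ → Set
Adjacency n = Fin n → Fin n → Bool

data Reach {n : ℕ} (Adj : Adjacency n) : Fin n → Fin n → Set where
  here : ∀ {u} → Reach Adj u u
  step : ∀ {u w v} → Adj u w ≡ true → Reach Adj w v → Reach Adj u v

HasCycle : {n : ℕ} → Adjacency n → Set
HasCycle {n} Adj =
  Σ (Fin n) λ v₀ → Σ (List (Fin n)) λ rest →
    (2 ≤ length rest) × Unique (v₀ ∷ rest) ×
    Linked (λ a b → Adj a b ≡ true) (v₀ ∷ rest ++ [ v₀ ])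

record IsTree {n : ℕ} (U : Subset n) (Adj : Adjacency n) : Set where
  field
    symm      : ∀ u v → Adj u v ≡ Adj v u
    irrefl    : ∀ u → Adj u u ≡ false
    inside    : ∀ u v → Adj u v ≡ true → u ∈ U × v ∈ U
    connected : ∀ u v → u ∈ U → v ∈ U → Reach Adj u v
    acyclic   : ¬ HasCycle Adj

deg : {n : ℕ} → Adjacency n → Fin n → ℕ
deg Adj v = ∣ tabulate (Adj v) ∣

record IsGluingTree {n : ℕ} (U : Subset n) (Adj : Adjacency n)
                    (I J : Subset n) : Set where
  field
    tree        : IsTree U Adj
    I⊆U         : I ⊆ U
    J⊆U         : J ⊆ U
    disjoint    : ∀ v → v ∈ I → v ∉ J
    nonadjacent : ∀ u v → u ∈ I ∪ J → v ∈ I ∪ J → Adj u v ≡ false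
    I-leaves    : ∀ v → v ∈ I → deg Adj v ≡ 1
    J-degree2   : ∀ v → v ∈ J → deg Adj v ≡ 2

-- DAGs with skeleton T, given as Bool arc relations D (D u v = true : u → v)

data DPath {n : ℕ} (D : Adjacency n) : Fin n → Fin n → Set where
  arc  : ∀ {u v} → D u v ≡ true → DPath D u v
  _▸_  : ∀ {u w v} → D u w ≡ true → DPath D w v → DPath D u v

record IsAdmissibleDAG {n : ℕ} (Adj : Adjacency n) (J : Subset n)
                       (D : Adjacency n) : Set where
  field
    arcs-edges : ∀ u v → D u v ≡ true → Adj u v ≡ true
    edges-arcs : ∀ u v → Adj u v ≡ true → D u v ≡ true ⊎ D v u ≡ true
    antisym    : ∀ u v → D u v ≡ true → D v u ≡ false
    acyclic    : ∀ v → ¬ DPath D v v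
    J-chain    : ∀ j i k → j ∈ J → i ≢ k → Adj i j ≡ true → Adj k j ≡ true →
                 (D i j ≡ true × D j k ≡ true) ⊎ (D j i ≡ true × D k j ≡ true)

-- The augmented DAG 𝒯^{I∪J}: vertices inj₁ v (old v) and inj₂ v (new v'),
-- where v' is only attached (v' → v) when v ∈ I∪J.

AugV : ℕ → Set
AugV n = Fin n ⊎ Fin n

-- subsets of augmented vertices: (old part , primed part)
AugSet : ℕ → Set
AugSet n = Subset n × Subset n

_∈A_ : {n : ℕ} → AugV n → AugSet n → Set
inj₁ v ∈A A = v ∈ proj₁ A
inj₂ v ∈A A = v ∈ proj₂ A

memA : {n : ℕ} → AugV n → AugSet n → Bool
memA (inj₁ v) A = lookup (proj₁ A) v
memA (inj₂ v) A = lookup (proj₂ A) v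

sizeA : {n : ℕ} → AugSet n → ℕ
sizeA A = ∣ proj₁ A ∣ ℕ.+ ∣ proj₂ A ∣

eqA : {n : ℕ} → AugV n → AugV n → Bool
eqA (inj₁ a) (inj₁ b) = ⌊ a ≟ b ⌋
eqA (inj₂ a) (inj₂ b) = ⌊ a ≟ b ⌋
eqA _ _ = false

AugAdj : {n : ℕ} → Adjacency n → Subset n → AugV n → AugV n → Set
AugAdj Adj IJ (inj₁ a) (inj₁ b) = Adj a b ≡ true
AugAdj Adj IJ (inj₂ a) (inj₁ b) = a ≡ b × a ∈ IJ
AugAdj Adj IJ (inj₁ a) (inj₂ b) = a ≡ b × b ∈ IJ
AugAdj Adj IJ (inj₂ a) (inj₂ b) = ⊥

-- parB D IJ b a = true  iff  b → a in 𝒯^{I∪J}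
parB : {n : ℕ} → Adjacency n → Subset n → AugV n → AugV n → Bool
parB D IJ (inj₁ b) (inj₁ a) = D b a
parB D IJ (inj₂ v) (inj₁ w) = ⌊ v ≟ w ⌋ ∧ lookup IJ v
parB D IJ _ _ = false

anyFin : {m : ℕ} → (Fin m → Bool) → Bool
anyFin {zero}  f = false
anyFin {suc m} f = f zero ∨ anyFin (λ i → f (suc i))

allFin : {m : ℕ} → (Fin m → Bool) → Bool
allFin {zero}  f = true
allFin {suc m} f = f zero ∧ allFin (λ i → f (suc i))

anyA : {n : ℕ} → (AugV n → Bool) → Bool
anyA f = anyFin (λ v → f (inj₁ v)) ∨ anyFin (λ v → f (inj₂ v))

allA : {n : ℕ} → (AugV n → Bool) → Bool
allA f = allFin (λ v → f (inj₁ v)) ∧ allFin (λ v → f (inj₂ v))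

cB : {n : ℕ} → Adjacency n → Subset n → AugSet n → Bool
cB D IJ A = anyA λ a → memA a A ∧
              allA λ b → not (memA b A) ∨ eqA b a ∨ parB D IJ b a

cim : {n : ℕ} → Adjacency n → Subset n → AugSet n → ℚ
cim D IJ A = if cB D IJ A then 1ℚ else 0ℚ

-- coordinates of CIM_T^{I,J}: vertex sets of stars of T^{I∪J}
-- (a centre together with at least two of its neighbours)
IsStar : {n : ℕ} → Adjacency n → Subset n → AugSet n → Set
IsStar {n} Adj IJ A =
  Σ (AugV n) λ c → c ∈A A ×
    (∀ w → w ∈A A → w ≢ c → AugAdj Adj IJ c w) × (3 ≤ sizeA A)

-- Points are x : AugSet n → ℚ (only the listed coordinates matter).
-- x lies in the image of CIM_T^{I,J} under projection onto the star
-- coordinates A with Keep A, iff x agrees there with a finite convex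
-- combination of the vectors c_{𝒯^{I∪J}}, 𝒯 admissible.

Weighted : ℕ → Set
Weighted n = ℚ × Adjacency n

sumW : {n : ℕ} → List (Weighted n) → ℚ
sumW [] = 0ℚ
sumW ((w , _) ∷ L) = w + sumW L

combo : {n : ℕ} → Subset n → List (Weighted n) → AugSet n → ℚ
combo IJ [] A = 0ℚ
combo IJ ((w , D) ∷ L) A = w * cim D IJ A + combo IJ L A

InCIMon : {n : ℕ} → Adjacency n → (I J : Subset n) →
          (AugSet n → Set) → (AugSet n → ℚ) → Set
InCIMon {n} Adj I J Keep x =
  Σ (List (Weighted n)) λ L →
    All (λ p → (0ℚ ≤ℚ proj₁ p) × IsAdmissibleDAG Adj J (proj₂ p)) L ×
    (sumW L ≡ 1ℚ) ×
    (∀ A → IsStar Adj (I ∪ J) A → Keep A → x A ≡ combo (I ∪ J) L A)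

InCIM : {n : ℕ} → Adjacency n → (I J : Subset n) → (AugSet n → ℚ) → Set
InCIM Adj I J = InCIMon Adj I J (λ _ → ⊤)

cut : {n : ℕ} → Adjacency n → Fin n → Fin n → Adjacency n
cut Adj a b u v = Adj u v ∧ not ((⌊ u ≟ a ⌋ ∧ ⌊ v ≟ b ⌋) ∨ (⌊ u ≟ b ⌋ ∧ ⌊ v ≟ a ⌋))

restrict : {n : ℕ} → Adjacency n → Subset n → Adjacency n
restrict Adj W u v = Adj u v ∧ lookup W u ∧ lookup W v

partI : {n : ℕ} → Subset n → Fin n → Subset n → Subset n
partI I j W = (I ∪ ⁅ j ⁆) ∩ W

partJ : {n : ℕ} → Subset n → Fin n → Subset n → Subset n
partJ J j W = (J ∩ ∁ ⁅ j ⁆) ∩ W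

setA : {n : ℕ} → List (Fin n) → List (Fin n) → AugSet n
setA {n} xs ys = go xs , go ys
  where
  go : List (Fin n) → Subset n
  go [] = Data.Fin.Subset.⊥
  go (v ∷ vs) = ⁅ v ⁆ ∪ go vs

{-# OPTIONS --safe #-}

-- Cutting T at j gives parts Tⁱ ∋ i and Tᵏ ∋ k that share only the vertex j, since j has degree
-- two. Every star of T other than {i,j,k} and {i,j,k,j′} is a star of one of the parts, and as T
-- has no triangles the c-value of such a star only depends on the arcs inside its part. Hence
-- restricting the DAGs of a convex combination to the parts gives points of both part polytopes,
-- and c({i,j,j′}) + c({j,k,j′}) = 1 because i → j → k or i ← j ← k; the coordinates {i,j,k} and
-- {i,j,k,j′} vanish because no vertex of {i,j,k} is a common child of the other two.
-- Conversely, for convex combinations on the two parts the hyperplane equation says that the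
-- i-side gives the arc i → j the same total weight as the k-side gives the arc j → k. Coupling the
-- two distributions along this common binary marginal and gluing every compatible pair of DAGs at
-- j produces DAGs with skeleton T (acyclic, as every orientation of a tree is) whose convex
-- combination has the prescribed coordinates.

module Submission where

open import Defs
open import Data.Nat using (ℕ; zero; suc; z≤n; s≤s) renaming (_≤_ to _≤ℕ_)
import Data.Nat.Properties as ℕ
open import Data.Bool using (Bool; true; false; _∧_; _∨_; not; if_then_else_)
open import Data.Bool.Properties using (∧-conicalˡ; ∧-conicalʳ; ∧-zeroʳ; ∧-identityʳ; ¬-not)
import Data.Bool as Bool
open import Data.Fin using (Fin; zero; suc; _≟_)
open import Data.Fin.Subset using (Subset; _∈_; _∉_; _⊆_; ⁅_⁆; _∪_; ∣_∣; _-_)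
import Data.Fin.Subset as Subset
open import Data.Fin.Subset.Properties
  using (x∈p∪q⁺; x∈p∪q⁻; x∈p∩q⁺; x∈p∩q⁻; x∈⁅x⁆; x∈⁅y⁆⇒x≡y; x≢y⇒x∉⁅y⁆; x∉p⇒x∈∁p;
         ∉⊥; ⊆-antisym; _∈?_; x∈p⇒∣p-x∣<∣p∣; x∈p∧x≢y⇒x∈p-y)
open import Data.Vec using (lookup; tabulate)
open import Data.Vec.Properties using ([]=⇒lookup; lookup⇒[]=; lookup∘tabulate)
open import Data.List using (List; []; _∷_; _++_; [_]; length; concatMap)
import Data.List
open import Data.List.Relation.Unary.All as All using (All; []; _∷_)
open import Data.List.Relation.Unary.All.Properties using (concat⁺; map⁺; ¬Any⇒All¬)
open import Data.List.Relation.Unary.Unique.Propositional using (Unique)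
open import Data.List.Relation.Unary.AllPairs using ([]; _∷_)
open import Data.List.Relation.Unary.Linked using (Linked; []; [-]; _∷_)
open import Data.List.Relation.Unary.Any using (Any; here; there; any?)
open import Data.List.Relation.Unary.Any.Properties using (singleton⁻)
open import Data.Product using (Σ; ∃-syntax; _×_; _,_; proj₁; proj₂)
import Data.Product as Product
open import Data.Sum using (_⊎_; inj₁; inj₂)
import Data.Sum as Sum
open import Data.Empty using (⊥; ⊥-elim)
open import Data.Unit using (⊤; tt)
open import Data.Rational using (ℚ; 0ℚ; 1ℚ; _+_; _*_; 1/_; NonZero; Positive; nonNegative; ≢-nonZero)
  renaming (_≤_ to _≤ℚ_)
open import Data.Rational.Properties as ℚ
  using (+-identityˡ; +-identityʳ; *-identityʳ; *-zeroʳ; *-distribˡ-+; +-assoc;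
         ≤-refl; ≤-antisym; +-mono-≤; *-inverseˡ; nonNegative⁻¹; nonNeg*nonNeg⇒nonNeg;
         nonNeg∧nonZero⇒pos; 1/pos⇒pos; pos⇒nonNeg)
open import Data.Rational.Solver using (module +-*-Solver)
open import Algebra.Properties.Group ℚ.+-0-group using ()
  renaming (∙-cancelˡ to +-cancelˡ; ∙-cancelʳ to +-cancelʳ)
open import Function using (_∘_)
open import Function.Bundles using (_⇔_; mk⇔; Equivalence)
open import Relation.Nullary using (¬_; Dec; yes; no; does; ⌊_⌋; contradiction)
open import Relation.Nullary.Decidable using (_×-dec_; _⊎-dec_; isYes≗does; dec-true; dec-false)
open import Relation.Binary.PropositionalEquality hiding ([_])

private
  variable
    n : ℕ

∨-true⁻ : ∀ {a b} → a ∨ b ≡ true → a ≡ true ⊎ b ≡ true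
∨-true⁻ {true}  _ = inj₁ refl
∨-true⁻ {false} e = inj₂ e

∨-true⁺ʳ : ∀ a {b} → b ≡ true → a ∨ b ≡ true
∨-true⁺ʳ true  _ = refl
∨-true⁺ʳ false e = e

true≢false : true ≢ false
true≢false ()

≡true-ext : ∀ {a b} → (a ≡ true → b ≡ true) → (b ≡ true → a ≡ true) → a ≡ b
≡true-ext {true}  {true}  _ _ = refl
≡true-ext {true}  {false} f _ = sym (f refl)
≡true-ext {false} {true}  _ g = g refl
≡true-ext {false} {false} _ _ = refl

∈⇒lookup : ∀ {p : Subset n} {x} → x ∈ p → lookup p x ≡ true
∈⇒lookup = []=⇒lookup

lookup⇒∈ : ∀ {p : Subset n} {x} → lookup p x ≡ true → x ∈ p
lookup⇒∈ {p = p} {x} = lookup⇒[]= x p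

suc≤∣p∣ : ∀ {p : Subset n} {x k} → x ∈ p → k ≤ℕ ∣ p - x ∣ → suc k ≤ℕ ∣ p ∣
suc≤∣p∣ x∈p k≤ = ℕ.≤-<-trans k≤ (x∈p⇒∣p-x∣<∣p∣ x∈p)

1≤∣p∣ : ∀ {p : Subset n} {x} → x ∈ p → 1 ≤ℕ ∣ p ∣
1≤∣p∣ x∈p = suc≤∣p∣ x∈p z≤n

2≤∣p∣ : ∀ {p : Subset n} {x y} → x ∈ p → y ∈ p → y ≢ x → 2 ≤ℕ ∣ p ∣
2≤∣p∣ x∈p y∈p y≢x = suc≤∣p∣ x∈p (1≤∣p∣ (x∈p∧x≢y⇒x∈p-y y∈p y≢x))

3≤∣p∣ : ∀ {p : Subset n} {x y z} → x ∈ p → y ∈ p → z ∈ p → y ≢ x → z ≢ x → z ≢ y → 3 ≤ℕ ∣ p ∣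
3≤∣p∣ x∈p y∈p z∈p y≢x z≢x z≢y =
  suc≤∣p∣ x∈p (2≤∣p∣ (x∈p∧x≢y⇒x∈p-y y∈p y≢x) (x∈p∧x≢y⇒x∈p-y z∈p z≢x) z≢y)

-- On literal lists, setA xs ys unfolds to (fromList xs , fromList ys).
fromList : List (Fin n) → Subset n
fromList []       = Subset.⊥
fromList (v ∷ vs) = ⁅ v ⁆ ∪ fromList vs

∈-fromList⁻ : ∀ {v : Fin n} xs → v ∈ fromList xs → Any (v ≡_) xs
∈-fromList⁻ []       m = contradiction m ∉⊥
∈-fromList⁻ (x ∷ xs) m with x∈p∪q⁻ ⁅ x ⁆ (fromList xs) m
... | inj₁ v∈x  = here (x∈⁅y⁆⇒x≡y x v∈x)
... | inj₂ v∈xs = there (∈-fromList⁻ xs v∈xs)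

∈-fromList⁺ : ∀ {v : Fin n} xs → Any (v ≡_) xs → v ∈ fromList xs
∈-fromList⁺ (x ∷ _)  (here refl) = x∈p∪q⁺ (inj₁ (x∈⁅x⁆ x))
∈-fromList⁺ (_ ∷ xs) (there m)   = x∈p∪q⁺ (inj₂ (∈-fromList⁺ xs m))

∈A⇒memA : ∀ (a : AugV n) {A} → a ∈A A → memA a A ≡ true
∈A⇒memA (inj₁ _) = ∈⇒lookup
∈A⇒memA (inj₂ _) = ∈⇒lookup

memA⇒∈A : ∀ (a : AugV n) {A} → memA a A ≡ true → a ∈A A
memA⇒∈A (inj₁ _) = lookup⇒∈
memA⇒∈A (inj₂ _) = lookup⇒∈

≟⇒≡ : ∀ {x y : Fin n} → ⌊ x ≟ y ⌋ ≡ true → x ≡ y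
≟⇒≡ {x = x} {y} e with x ≟ y
... | yes x≡y = x≡y

≟-refl : ∀ (x : Fin n) → ⌊ x ≟ x ⌋ ≡ true
≟-refl x = trans (isYes≗does (x ≟ x)) (dec-true (x ≟ x) refl)

≟-≢ : ∀ {x y : Fin n} → x ≢ y → ⌊ x ≟ y ⌋ ≡ false
≟-≢ {x = x} {y} x≢y = trans (isYes≗does (x ≟ y)) (dec-false (x ≟ y) x≢y)

eqA⇒≡ : ∀ (a b : AugV n) → eqA a b ≡ true → a ≡ b
eqA⇒≡ (inj₁ _) (inj₁ _) e = cong inj₁ (≟⇒≡ e)
eqA⇒≡ (inj₂ _) (inj₂ _) e = cong inj₂ (≟⇒≡ e)

eqA-refl : ∀ (a : AugV n) → eqA a a ≡ true
eqA-refl (inj₁ a) = ≟-refl a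
eqA-refl (inj₂ a) = ≟-refl a

anyFin⁻ : ∀ {m} (f : Fin m → Bool) → anyFin f ≡ true → ∃[ x ] f x ≡ true
anyFin⁻ {suc m} f e with f zero in f0
... | true  = zero , f0
... | false = let x , fx = anyFin⁻ (f ∘ suc) e in suc x , fx

anyFin⁺ : ∀ {m} (f : Fin m → Bool) x → f x ≡ true → anyFin f ≡ true
anyFin⁺ f zero    e rewrite e = refl
anyFin⁺ f (suc x) e = ∨-true⁺ʳ (f zero) (anyFin⁺ (f ∘ suc) x e)

allFin⁻ : ∀ {m} (f : Fin m → Bool) → allFin f ≡ true → ∀ x → f x ≡ true
allFin⁻ f e zero    = ∧-conicalˡ _ _ e
allFin⁻ f e (suc x) = allFin⁻ (f ∘ suc) (∧-conicalʳ _ _ e) x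

allFin⁺ : ∀ {m} (f : Fin m → Bool) → (∀ x → f x ≡ true) → allFin f ≡ true
allFin⁺ {zero}  f h = refl
allFin⁺ {suc m} f h = cong₂ _∧_ (h zero) (allFin⁺ (f ∘ suc) (h ∘ suc))

anyA⁻ : ∀ (f : AugV n → Bool) → anyA f ≡ true → ∃[ x ] f x ≡ true
anyA⁻ f e with ∨-true⁻ e
... | inj₁ e₁ = let x , fx = anyFin⁻ _ e₁ in inj₁ x , fx
... | inj₂ e₂ = let x , fx = anyFin⁻ _ e₂ in inj₂ x , fx

anyA⁺ : ∀ (f : AugV n → Bool) x → f x ≡ true → anyA f ≡ true
anyA⁺ f (inj₁ x) e = cong (_∨ anyFin (f ∘ inj₂)) (anyFin⁺ (f ∘ inj₁) x e)
anyA⁺ f (inj₂ x) e = ∨-true⁺ʳ (anyFin (f ∘ inj₁)) (anyFin⁺ (f ∘ inj₂) x e)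

allA⁻ : ∀ (f : AugV n → Bool) → allA f ≡ true → ∀ x → f x ≡ true
allA⁻ f e (inj₁ x) = allFin⁻ _ (∧-conicalˡ _ _ e) x
allA⁻ f e (inj₂ x) = allFin⁻ _ (∧-conicalʳ _ _ e) x

allA⁺ : ∀ (f : AugV n → Bool) → (∀ x → f x ≡ true) → allA f ≡ true
allA⁺ f h = cong₂ _∧_ (allFin⁺ _ (h ∘ inj₁)) (allFin⁺ _ (h ∘ inj₂))

HasSink : Adjacency n → Subset n → AugSet n → Set
HasSink {n} D IJ A =
  Σ (AugV n) λ a → a ∈A A × (∀ b → b ∈A A → b ≢ a → parB D IJ b a ≡ true)

sinkTest : Adjacency n → Subset n → AugSet n → AugV n → AugV n → Bool
sinkTest D IJ A a b = not (memA b A) ∨ eqA b a ∨ parB D IJ b a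

cB⇒HasSink : ∀ D IJ (A : AugSet n) → cB D IJ A ≡ true → HasSink D IJ A
cB⇒HasSink D IJ A e with anyA⁻ (λ a → memA a A ∧ allA (sinkTest D IJ A a)) e
... | a , p = a , memA⇒∈A a (∧-conicalˡ _ _ p) , parent
  where
  parent : ∀ b → b ∈A A → b ≢ a → parB D IJ b a ≡ true
  parent b b∈A b≢a with allA⁻ (sinkTest D IJ A a) (∧-conicalʳ (memA a A) _ p) b
  ... | q rewrite ∈A⇒memA b b∈A with ∨-true⁻ q
  ... | inj₁ b≡a = contradiction (eqA⇒≡ b a b≡a) b≢a
  ... | inj₂ b→a = b→a

HasSink⇒cB : ∀ D IJ (A : AugSet n) → HasSink D IJ A → cB D IJ A ≡ true
HasSink⇒cB D IJ A (a , a∈A , parent) =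
  anyA⁺ (λ a → memA a A ∧ allA (sinkTest D IJ A a)) a
    (cong₂ _∧_ (∈A⇒memA a a∈A) (allA⁺ (sinkTest D IJ A a) parent-or-absent))
  where
  parent-or-absent : ∀ b → sinkTest D IJ A a b ≡ true
  parent-or-absent b with memA b A in b∈A | eqA b a in b≟a
  ... | false | _     = refl
  ... | true  | true  = refl
  ... | true  | false =
    parent b (memA⇒∈A b b∈A) (λ { refl → true≢false (trans (sym (eqA-refl b)) b≟a) })

cB-false : ∀ D IJ (A : AugSet n) →
  (∀ a → a ∈A A → ∃[ b ] b ∈A A × b ≢ a × parB D IJ b a ≡ false) → cB D IJ A ≡ false
cB-false D IJ A noSink = ¬-not λ e →
  let a , a∈A , parent = cB⇒HasSink D IJ A e
      b , b∈A , b≢a , ¬b→a = noSink a a∈A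
  in true≢false (trans (sym (parent b b∈A b≢a)) ¬b→a)

cB-cong : ∀ D IJ D′ IJ′ (A : AugSet n) →
  (∀ a b → a ∈A A → b ∈A A → b ≢ a → parB D IJ b a ≡ parB D′ IJ′ b a) →
  cB D IJ A ≡ cB D′ IJ′ A
cB-cong D IJ D′ IJ′ A same = ≡true-ext
  (λ e → let a , a∈A , parent = cB⇒HasSink D IJ A e in HasSink⇒cB D′ IJ′ A
     (a , a∈A , λ b b∈A b≢a → trans (sym (same a b a∈A b∈A b≢a)) (parent b b∈A b≢a)))
  (λ e → let a , a∈A , parent = cB⇒HasSink D′ IJ′ A e in HasSink⇒cB D IJ A
     (a , a∈A , λ b b∈A b≢a → trans (same a b a∈A b∈A b≢a) (parent b b∈A b≢a)))

0≤+ : ∀ {p q} → 0ℚ ≤ℚ p → 0ℚ ≤ℚ q → 0ℚ ≤ℚ p + q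
0≤+ {p} {q} 0≤p 0≤q = subst (_≤ℚ p + q) (+-identityˡ 0ℚ) (+-mono-≤ 0≤p 0≤q)

0≤* : ∀ {p q} → 0ℚ ≤ℚ p → 0ℚ ≤ℚ q → 0ℚ ≤ℚ p * q
0≤* {p} {q} 0≤p 0≤q =
  nonNegative⁻¹ (p * q) {{nonNeg*nonNeg⇒nonNeg p {{nonNegative 0≤p}} q {{nonNegative 0≤q}}}}

≤-+ʳ : ∀ {p q} → 0ℚ ≤ℚ q → p ≤ℚ p + q
≤-+ʳ {p} {q} 0≤q = subst (_≤ℚ p + q) (+-identityʳ p) (+-mono-≤ (≤-refl {p}) 0≤q)

≤-+ˡ : ∀ {p q} → 0ℚ ≤ℚ p → q ≤ℚ p + q
≤-+ˡ {p} {q} 0≤p = subst (_≤ℚ p + q) (+-identityˡ q) (+-mono-≤ 0≤p (≤-refl {q}))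

-- The reciprocal, with 1/0 = 0.
inv : ℚ → ℚ
inv q with q ℚ.≟ 0ℚ
... | yes _  = 0ℚ
... | no q≢0 = (1/ q) {{≢-nonZero q≢0}}

0≤inv : ∀ {q} → 0ℚ ≤ℚ q → 0ℚ ≤ℚ inv q
0≤inv {q} 0≤q with q ℚ.≟ 0ℚ
... | yes _  = ≤-refl
... | no q≢0 = nonNegative⁻¹ (1/ q) {{pos⇒nonNeg (1/ q) {{1/pos⇒pos q}}}}
  where
  instance
    0<q : Positive q
    0<q = nonNeg∧nonZero⇒pos q {{nonNegative 0≤q}} {{≢-nonZero q≢0}}
    q≢0′ : NonZero q
    q≢0′ = ℚ.pos⇒nonZero q

*-inv-cancel : ∀ {w s} → 0ℚ ≤ℚ w → w ≤ℚ s → w * inv s * s ≡ w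
*-inv-cancel {w} {s} 0≤w w≤s with s ℚ.≟ 0ℚ
... | yes refl = trans (*-zeroʳ (w * 0ℚ)) (sym (≤-antisym w≤s 0≤w))
... | no s≢0 = begin
  w * (1/ s) {{≢-nonZero s≢0}} * s   ≡⟨ ℚ.*-assoc w _ s ⟩
  w * ((1/ s) {{≢-nonZero s≢0}} * s) ≡⟨ cong (w *_) (*-inverseˡ s {{≢-nonZero s≢0}}) ⟩
  w * 1ℚ                            ≡⟨ *-identityʳ w ⟩
  w                                 ∎
  where open ≡-Reasoning

when : Bool → ℚ → ℚ
when b q = if b then q else 0ℚ

when-*ˡ : ∀ b p q → when b (p * q) ≡ p * when b q
when-*ˡ true  p q = refl
when-*ˡ false p q = sym (*-zeroʳ p)

0≤when : ∀ b {q} → 0ℚ ≤ℚ q → 0ℚ ≤ℚ when b q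
0≤when true  0≤q = 0≤q
0≤when false _   = ≤-refl

*-indicator : ∀ w b → w * (if b then 1ℚ else 0ℚ) ≡ when b w
*-indicator w true  = *-identityʳ w
*-indicator w false = *-zeroʳ w

module _ {A : Set} where

  sumBy : (A → ℚ) → List A → ℚ
  sumBy f []       = 0ℚ
  sumBy f (x ∷ xs) = f x + sumBy f xs

  sumBy-cong : ∀ {f g : A → ℚ} {xs} → All (λ x → f x ≡ g x) xs → sumBy f xs ≡ sumBy g xs
  sumBy-cong []       = refl
  sumBy-cong (e ∷ es) = cong₂ _+_ e (sumBy-cong es)

  sumBy-ext : ∀ {f g : A → ℚ} → (∀ x → f x ≡ g x) → ∀ xs → sumBy f xs ≡ sumBy g xs
  sumBy-ext f≗g xs = sumBy-cong (All.universal f≗g xs)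

  sumBy-zero : ∀ xs → sumBy (λ _ → 0ℚ) xs ≡ 0ℚ
  sumBy-zero []       = refl
  sumBy-zero (x ∷ xs) = trans (+-identityˡ _) (sumBy-zero xs)

  sumBy-*ˡ : ∀ c (f : A → ℚ) xs → sumBy (λ x → c * f x) xs ≡ c * sumBy f xs
  sumBy-*ˡ c f []       = sym (*-zeroʳ c)
  sumBy-*ˡ c f (x ∷ xs) = trans (cong (c * f x +_) (sumBy-*ˡ c f xs)) (sym (*-distribˡ-+ c _ _))

  sumBy-+ : ∀ (f g : A → ℚ) xs → sumBy (λ x → f x + g x) xs ≡ sumBy f xs + sumBy g xs
  sumBy-+ f g []       = sym (+-identityˡ 0ℚ)
  sumBy-+ f g (x ∷ xs) rewrite sumBy-+ f g xs = interchange (f x) (g x) (sumBy f xs) (sumBy g xs)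
    where
    open +-*-Solver
    interchange : ∀ a b c d → (a + b) + (c + d) ≡ (a + c) + (b + d)
    interchange = solve 4 (λ a b c d → (a :+ b) :+ (c :+ d) := (a :+ c) :+ (b :+ d)) refl

  sumBy-++ : ∀ (f : A → ℚ) xs ys → sumBy f (xs ++ ys) ≡ sumBy f xs + sumBy f ys
  sumBy-++ f []       ys = sym (+-identityˡ _)
  sumBy-++ f (x ∷ xs) ys = trans (cong (f x +_) (sumBy-++ f xs ys)) (sym (+-assoc (f x) _ _))

  0≤sumBy : ∀ {f : A → ℚ} {xs} → All (λ x → 0ℚ ≤ℚ f x) xs → 0ℚ ≤ℚ sumBy f xs
  0≤sumBy []         = ≤-refl
  0≤sumBy (0≤x ∷ nn) = 0≤+ 0≤x (0≤sumBy nn)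

sumBy-concatMap : ∀ {A B : Set} (f : B → ℚ) (g : A → List B) xs →
                  sumBy f (concatMap g xs) ≡ sumBy (sumBy f ∘ g) xs
sumBy-concatMap f g []       = refl
sumBy-concatMap f g (x ∷ xs) = trans (sumBy-++ f (g x) _) (cong (sumBy f (g x) +_) (sumBy-concatMap f g xs))

sumBy-map : ∀ {A B : Set} (f : B → ℚ) (g : A → B) xs → sumBy f (Data.List.map g xs) ≡ sumBy (f ∘ g) xs
sumBy-map f g []       = refl
sumBy-map f g (x ∷ xs) = cong (f (g x) +_) (sumBy-map f g xs)

sumBy-swap : ∀ {A B : Set} (f : A → B → ℚ) xs ys →
             sumBy (λ x → sumBy (f x) ys) xs ≡ sumBy (λ y → sumBy (λ x → f x y) xs) ys
sumBy-swap f []       ys = sym (sumBy-zero ys)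
sumBy-swap f (x ∷ xs) ys =
  trans (cong (sumBy (f x) ys +_) (sumBy-swap f xs ys)) (sym (sumBy-+ (f x) _ ys))

-- Coupling two distributions with a common binary marginal

Weights : Set → Set
Weights A = List (ℚ × A)

NonNegativeWeights : {A : Set} → Weights A → Set
NonNegativeWeights = All (λ e → 0ℚ ≤ℚ proj₁ e)

≟ᵇ-sym : ∀ b c → ⌊ b Bool.≟ c ⌋ ≡ ⌊ c Bool.≟ b ⌋
≟ᵇ-sym true  true  = refl
≟ᵇ-sym true  false = refl
≟ᵇ-sym false true  = refl
≟ᵇ-sym false false = refl

≟ᵇ-refl : ∀ b → ⌊ b Bool.≟ b ⌋ ≡ true
≟ᵇ-refl true  = refl
≟ᵇ-refl false = refl

≟ᵇ-true : ∀ b → ⌊ b Bool.≟ true ⌋ ≡ b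
≟ᵇ-true true  = refl
≟ᵇ-true false = refl

≟ᵇ-not : ∀ b → ⌊ not b Bool.≟ true ⌋ ≡ ⌊ b Bool.≟ false ⌋
≟ᵇ-not true  = refl
≟ᵇ-not false = refl

≟ᵇ⇒≡ : ∀ {b c} → ⌊ b Bool.≟ c ⌋ ≡ true → b ≡ c
≟ᵇ⇒≡ {true}  {true}  _ = refl
≟ᵇ⇒≡ {false} {false} _ = refl

module _ {A : Set} (β : A → Bool) where

  mass : Weights A → Bool → ℚ
  mass L b = sumBy (λ e → when ⌊ β (proj₂ e) Bool.≟ b ⌋ (proj₁ e)) L

  mass-true+false : ∀ L → mass L true + mass L false ≡ sumBy proj₁ L
  mass-true+false L = trans (sym (sumBy-+ _ _ L)) (sumBy-ext split L)
    where
    split : ∀ e → when ⌊ β (proj₂ e) Bool.≟ true ⌋ (proj₁ e) + when ⌊ β (proj₂ e) Bool.≟ false ⌋ (proj₁ e)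
                ≡ proj₁ e
    split e with β (proj₂ e)
    ... | true  = +-identityʳ (proj₁ e)
    ... | false = +-identityˡ (proj₁ e)

  0≤mass : ∀ {L} → NonNegativeWeights L → ∀ b → 0ℚ ≤ℚ mass L b
  0≤mass nn b = 0≤sumBy (All.map (0≤when _) nn)

  weight≤mass : ∀ {L} → NonNegativeWeights L → All (λ e → proj₁ e ≤ℚ mass L (β (proj₂ e))) L
  weight≤mass {(w , a) ∷ L} (0≤w ∷ nn) =
    subst (λ c → w ≤ℚ when c w + mass L (β a)) (sym (≟ᵇ-refl (β a))) (≤-+ʳ (0≤mass nn (β a)))
    ∷ All.map (λ {e} ≤m → ℚ.≤-trans ≤m (≤-+ˡ (0≤when ⌊ β a Bool.≟ β (proj₂ e) ⌋ 0≤w))) (weight≤mass nn)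
  weight≤mass {[]} [] = []

module Coupling {A B : Set} (β₁ : A → Bool) (β₂ : B → Bool) (L₁ : Weights A) (L₂ : Weights B)
                (nn₁ : NonNegativeWeights L₁) (nn₂ : NonNegativeWeights L₂)
                (same-mass : ∀ b → mass β₁ L₁ b ≡ mass β₂ L₂ b) where

  open ≡-Reasoning
  open +-*-Solver

  compatible : A → B → Bool
  compatible a b = ⌊ β₁ a Bool.≟ β₂ b ⌋

  -- A compatible pair gets weight w₁ w₂ / m, m the common mass of its label, so that summing
  -- over either coordinate returns w₁ resp. w₂. A label of mass 0 only carries zero weights,
  -- which makes the junk value 1/0 = 0 harmless.
  pairWeight : ℚ × A → ℚ × B → ℚ
  pairWeight (w₁ , a) (w₂ , b) = w₁ * w₂ * inv (mass β₁ L₁ (β₁ a))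

  pair : ℚ × A → ℚ × B → Weights (A × B)
  pair e₁ e₂ = if compatible (proj₂ e₁) (proj₂ e₂) then [ pairWeight e₁ e₂ , proj₂ e₁ , proj₂ e₂ ] else []

  coupling : Weights (A × B)
  coupling = concatMap (λ e₁ → concatMap (pair e₁) L₂) L₁

  sumBy-pair : ∀ (f : ℚ × (A × B) → ℚ) e₁ e₂ →
    sumBy f (pair e₁ e₂) ≡ when (compatible (proj₂ e₁) (proj₂ e₂)) (f (pairWeight e₁ e₂ , proj₂ e₁ , proj₂ e₂))
  sumBy-pair f e₁ e₂ with compatible (proj₂ e₁) (proj₂ e₂)
  ... | true  = +-identityʳ _
  ... | false = refl

  sumBy-coupling : ∀ (f : ℚ × (A × B) → ℚ) → sumBy f coupling ≡
    sumBy (λ e₁ → sumBy (λ e₂ → when (compatible (proj₂ e₁) (proj₂ e₂))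
                                     (f (pairWeight e₁ e₂ , proj₂ e₁ , proj₂ e₂))) L₂) L₁
  sumBy-coupling f = begin
    sumBy f coupling
      ≡⟨ sumBy-concatMap f _ L₁ ⟩
    sumBy (λ e₁ → sumBy f (concatMap (pair e₁) L₂)) L₁
      ≡⟨ sumBy-ext (λ e₁ → sumBy-concatMap f (pair e₁) L₂) L₁ ⟩
    sumBy (λ e₁ → sumBy (sumBy f ∘ pair e₁) L₂) L₁
      ≡⟨ sumBy-ext (λ e₁ → sumBy-ext (sumBy-pair f e₁) L₂) L₁ ⟩
    sumBy (λ e₁ → sumBy (λ e₂ → when (compatible (proj₂ e₁) (proj₂ e₂))
                                     (f (pairWeight e₁ e₂ , proj₂ e₁ , proj₂ e₂))) L₂) L₁ ∎

  marginal₁ : ∀ (h : A → ℚ) →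
    sumBy (λ e → proj₁ e * h (proj₁ (proj₂ e))) coupling ≡ sumBy (λ e₁ → proj₁ e₁ * h (proj₂ e₁)) L₁
  marginal₁ h = trans (sumBy-coupling _)
    (sumBy-cong (All.zipWith (λ (0≤w , w≤m) → row _ 0≤w w≤m) (nn₁ , weight≤mass β₁ nn₁)))
    where
    row : ∀ e₁ → 0ℚ ≤ℚ proj₁ e₁ → proj₁ e₁ ≤ℚ mass β₁ L₁ (β₁ (proj₂ e₁)) →
          sumBy (λ e₂ → when (compatible (proj₂ e₁) (proj₂ e₂)) (pairWeight e₁ e₂ * h (proj₂ e₁))) L₂
          ≡ proj₁ e₁ * h (proj₂ e₁)
    row (w₁ , a) 0≤w w≤m = begin
      sumBy (λ e₂ → when (compatible a (proj₂ e₂)) (w₁ * proj₁ e₂ * r * h a)) L₂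
        ≡⟨ sumBy-ext (λ e₂ → trans (cong (when _) (swap-w₂ (proj₁ e₂))) (when-*ˡ _ k (proj₁ e₂))) L₂ ⟩
      sumBy (λ e₂ → k * when (compatible a (proj₂ e₂)) (proj₁ e₂)) L₂
        ≡⟨ sumBy-*ˡ k _ L₂ ⟩
      k * sumBy (λ e₂ → when (compatible a (proj₂ e₂)) (proj₁ e₂)) L₂
        ≡⟨ cong (k *_) (sumBy-ext (λ e₂ → cong (λ c → when c (proj₁ e₂)) (≟ᵇ-sym (β₁ a) (β₂ (proj₂ e₂)))) L₂) ⟩
      k * mass β₂ L₂ (β₁ a)
        ≡⟨ cong (k *_) (sym (same-mass (β₁ a))) ⟩
      k * m
        ≡⟨⟩
      w₁ * r * h a * m
        ≡⟨ solve 4 (λ w r h m → w :* r :* h :* m := w :* r :* m :* h) refl w₁ r (h a) m ⟩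
      w₁ * r * m * h a
        ≡⟨ cong (_* h a) (*-inv-cancel 0≤w w≤m) ⟩
      w₁ * h a ∎
      where
      m r k : ℚ
      m = mass β₁ L₁ (β₁ a)
      r = inv m
      k = w₁ * r * h a
      swap-w₂ : ∀ w₂ → w₁ * w₂ * r * h a ≡ k * w₂
      swap-w₂ w₂ = solve 4 (λ w₁ w₂ r h → w₁ :* w₂ :* r :* h := w₁ :* r :* h :* w₂) refl w₁ w₂ r (h a)

  marginal₂ : ∀ (h : B → ℚ) →
    sumBy (λ e → proj₁ e * h (proj₂ (proj₂ e))) coupling ≡ sumBy (λ e₂ → proj₁ e₂ * h (proj₂ e₂)) L₂
  marginal₂ h = begin
    sumBy (λ e → proj₁ e * h (proj₂ (proj₂ e))) coupling
      ≡⟨ sumBy-coupling _ ⟩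
    sumBy (λ e₁ → sumBy (λ e₂ → term e₁ e₂) L₂) L₁
      ≡⟨ sumBy-swap term L₁ L₂ ⟩
    sumBy (λ e₂ → sumBy (λ e₁ → term e₁ e₂) L₁) L₂
      ≡⟨ sumBy-cong (All.zipWith (λ (0≤w , w≤m) → column _ 0≤w w≤m) (nn₂ , weight≤mass β₂ nn₂)) ⟩
    sumBy (λ e₂ → proj₁ e₂ * h (proj₂ e₂)) L₂ ∎
    where
    term : ℚ × A → ℚ × B → ℚ
    term e₁ e₂ = when (compatible (proj₂ e₁) (proj₂ e₂)) (pairWeight e₁ e₂ * h (proj₂ e₂))
    column : ∀ e₂ → 0ℚ ≤ℚ proj₁ e₂ → proj₁ e₂ ≤ℚ mass β₂ L₂ (β₂ (proj₂ e₂)) →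
             sumBy (λ e₁ → term e₁ e₂) L₁ ≡ proj₁ e₂ * h (proj₂ e₂)
    column (w₂ , b) 0≤w w≤m = begin
      sumBy (λ e₁ → term e₁ (w₂ , b)) L₁
        ≡⟨ sumBy-ext compatible-only L₁ ⟩
      sumBy (λ e₁ → k * when ⌊ β₁ (proj₂ e₁) Bool.≟ β₂ b ⌋ (proj₁ e₁)) L₁
        ≡⟨ sumBy-*ˡ k _ L₁ ⟩
      k * mass β₁ L₁ (β₂ b)
        ≡⟨⟩
      w₂ * r * h b * m
        ≡⟨ solve 4 (λ w r h m → w :* r :* h :* m := w :* r :* m :* h) refl w₂ r (h b) m ⟩
      w₂ * r * m * h b
        ≡⟨ cong (_* h b) (*-inv-cancel 0≤w (subst (w₂ ≤ℚ_) (sym (same-mass (β₂ b))) w≤m)) ⟩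
      w₂ * h b ∎
      where
      m r k : ℚ
      m = mass β₁ L₁ (β₂ b)
      r = inv m
      k = w₂ * r * h b
      compatible-only : ∀ e₁ → term e₁ (w₂ , b) ≡ k * when ⌊ β₁ (proj₂ e₁) Bool.≟ β₂ b ⌋ (proj₁ e₁)
      compatible-only (w₁ , a) with β₁ a Bool.≟ β₂ b
      ... | yes β₁a≡β₂b rewrite β₁a≡β₂b =
        solve 4 (λ w₁ w₂ r h → w₁ :* w₂ :* r :* h := w₂ :* r :* h :* w₁) refl w₁ w₂ r (h b)
      ... | no _ = sym (*-zeroʳ k)

  total-weight : sumBy proj₁ coupling ≡ sumBy proj₁ L₁
  total-weight = begin
    sumBy proj₁ coupling                           ≡⟨ sumBy-ext (λ e → sym (*-identityʳ (proj₁ e))) coupling ⟩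
    sumBy (λ e → proj₁ e * 1ℚ) coupling            ≡⟨ marginal₁ (λ _ → 1ℚ) ⟩
    sumBy (λ e₁ → proj₁ e₁ * 1ℚ) L₁                ≡⟨ sumBy-ext (λ e → *-identityʳ (proj₁ e)) L₁ ⟩
    sumBy proj₁ L₁                                 ∎

  coupling-All : ∀ {P : A → Set} {Q : B → Set} → All (P ∘ proj₂) L₁ → All (Q ∘ proj₂) L₂ →
    All (λ e → 0ℚ ≤ℚ proj₁ e × P (proj₁ (proj₂ e)) × Q (proj₂ (proj₂ e))
               × compatible (proj₁ (proj₂ e)) (proj₂ (proj₂ e)) ≡ true) coupling
  coupling-All {P} {Q} ps qs = concat⁺ (map⁺ (All.zipWith row (nn₁ , ps)))
    where
    cell : ∀ {e₁ e₂} → 0ℚ ≤ℚ proj₁ e₁ → P (proj₂ e₁) → 0ℚ ≤ℚ proj₁ e₂ → Q (proj₂ e₂) → All _ (pair e₁ e₂)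
    cell {w₁ , a} {w₂ , b} 0≤w₁ p 0≤w₂ q with compatible a b in c
    ... | true  = (0≤* (0≤* 0≤w₁ 0≤w₂) (0≤inv (0≤mass β₁ nn₁ (β₁ a))) , p , q , c) ∷ []
    ... | false = []
    row : ∀ {e₁} → 0ℚ ≤ℚ proj₁ e₁ × P (proj₂ e₁) → All _ (concatMap (pair e₁) L₂)
    row (0≤w₁ , p) = concat⁺ (map⁺ (All.zipWith (λ (0≤w₂ , q) → cell 0≤w₁ p 0≤w₂ q) (nn₂ , qs)))

SameEdge : Fin n → Fin n → Fin n → Fin n → Set
SameEdge a b u v = (u ≡ a × v ≡ b) ⊎ (u ≡ b × v ≡ a)

sameEdge? : (a b u v : Fin n) → Dec (SameEdge a b u v)
sameEdge? a b u v = (u ≟ a ×-dec v ≟ b) ⊎-dec (u ≟ b ×-dec v ≟ a)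

SameEdge-flip : ∀ {a b u v : Fin n} → SameEdge a b u v → SameEdge a b v u
SameEdge-flip = Sum.swap ∘ Sum.map Product.swap Product.swap

module _ (Adj : Adjacency n) (a b : Fin n) where

  cut≡ : ∀ u v → cut Adj a b u v ≡ Adj u v ∧ not (does (sameEdge? a b u v))
  cut≡ u v rewrite isYes≗does (u ≟ a) | isYes≗does (v ≟ b) | isYes≗does (u ≟ b) | isYes≗does (v ≟ a) = refl

  cut-removes : ∀ {u v} → SameEdge a b u v → cut Adj a b u v ≡ false
  cut-removes {u} {v} s = trans (cut≡ u v) (removed (sameEdge? a b u v))
    where
    removed : (d : Dec (SameEdge a b u v)) → Adj u v ∧ not (does d) ≡ false
    removed (yes _) = ∧-zeroʳ (Adj u v)
    removed (no ¬s) = contradiction s ¬s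

  cut-keeps : ∀ {u v} → ¬ SameEdge a b u v → cut Adj a b u v ≡ Adj u v
  cut-keeps {u} {v} ¬s = trans (cut≡ u v) (kept (sameEdge? a b u v))
    where
    kept : (d : Dec (SameEdge a b u v)) → Adj u v ∧ not (does d) ≡ Adj u v
    kept (yes s) = contradiction s ¬s
    kept (no _)  = ∧-identityʳ (Adj u v)

  cut⊆ : ∀ u v → cut Adj a b u v ≡ true → Adj u v ≡ true
  cut⊆ u v = ∧-conicalˡ _ _

  cut-false⇒SameEdge : ∀ u v → Adj u v ≡ true → cut Adj a b u v ≡ false → SameEdge a b u v
  cut-false⇒SameEdge u v uv cut-uv with sameEdge? a b u v
  ... | yes s = s
  ... | no ¬s = contradiction (trans (sym uv) (trans (sym (cut-keeps ¬s)) cut-uv)) true≢false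

  cut-sym : (∀ u v → Adj u v ≡ Adj v u) → ∀ u v → cut Adj a b u v ≡ true → cut Adj a b v u ≡ true
  cut-sym symm u v e with sameEdge? a b v u
  ... | yes s = contradiction (trans (sym e) (cut-removes (SameEdge-flip s))) true≢false
  ... | no ¬s = trans (cut-keeps ¬s) (trans (symm v u) (cut⊆ u v e))

module _ (Adj : Adjacency n) (W : Subset n) where

  restrict⊆ : ∀ u v → restrict Adj W u v ≡ true → Adj u v ≡ true
  restrict⊆ u v = ∧-conicalˡ _ _

  restrict-inside : ∀ u v → restrict Adj W u v ≡ true → u ∈ W × v ∈ W
  restrict-inside u v e = lookup⇒∈ (∧-conicalˡ _ _ inW) , lookup⇒∈ (∧-conicalʳ (lookup W u) _ inW)
    where
    inW : lookup W u ∧ lookup W v ≡ true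
    inW = ∧-conicalʳ (Adj u v) _ e

  restrict-intro : ∀ {u v} → Adj u v ≡ true → u ∈ W → v ∈ W → restrict Adj W u v ≡ true
  restrict-intro uv u∈W v∈W = cong₂ _∧_ uv (cong₂ _∧_ (∈⇒lookup u∈W) (∈⇒lookup v∈W))

module _ {R : Adjacency n} where

  reach-snoc : ∀ {a b c} → Reach R a b → R b c ≡ true → Reach R a c
  reach-snoc here         bc = step bc here
  reach-snoc (step ab rb) bc = step ab (reach-snoc rb bc)

  reach-++ : ∀ {a b c} → Reach R a b → Reach R b c → Reach R a c
  reach-++ here         q = q
  reach-++ (step ab p) q = step ab (reach-++ p q)

  reach-reverse : (∀ u v → R u v ≡ true → R v u ≡ true) → ∀ {a b} → Reach R a b → Reach R b a
  reach-reverse symm here                 = here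
  reach-reverse symm (step {u} {w} uw p) = reach-snoc (reach-reverse symm p) (symm u w uw)

  dpath⇒reach : ∀ {a b} → DPath R a b → Reach R a b
  dpath⇒reach (arc ab)  = step ab here
  dpath⇒reach (ab ▸ p) = step ab (dpath⇒reach p)

  data Path : Fin n → Fin n → List (Fin n) → Set where
    end : ∀ {u} → Path u u []
    _▹_ : ∀ {u w v xs} → R u w ≡ true → Path w v xs → Path u v (w ∷ xs)

  suffix : ∀ {u w v xs} → Path w v xs → Unique (w ∷ xs) → Any (u ≡_) (w ∷ xs) →
           ∃[ ys ] Path u v ys × Unique (u ∷ ys)
  suffix {xs = xs} p       uq       (here refl) = xs , p , uq
  suffix           (_ ▹ p) (_ ∷ uq) (there u∈)  = suffix p uq u∈

  reach⇒path : ∀ {u v} → Reach R u v → ∃[ xs ] Path u v xs × Unique (u ∷ xs)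
  reach⇒path here = [] , end , [] ∷ []
  reach⇒path {u} (step {w = w} uw r) with reach⇒path r
  ... | xs , p , uq with any? (u ≟_) (w ∷ xs)
  ... | yes u∈ = suffix p uq u∈
  ... | no  u∉ = w ∷ xs , uw ▹ p , ¬Any⇒All¬ (w ∷ xs) u∉ ∷ uq

reach-map : ∀ {R R′ : Adjacency n} → (∀ u v → R u v ≡ true → R′ u v ≡ true) →
            ∀ {a b} → Reach R a b → Reach R′ a b
reach-map f here                = here
reach-map f (step {u} {w} uw p) = step (f u w uw) (reach-map f p)

path-closed-linked : ∀ {R Adj : Adjacency n} → (∀ u v → R u v ≡ true → Adj u v ≡ true) →
  ∀ {u v z xs} → Path {R = R} u v xs → Adj v z ≡ true → Linked (λ a b → Adj a b ≡ true) (u ∷ xs ++ [ z ])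
path-closed-linked f end                vz = vz ∷ [-]
path-closed-linked f (_▹_ {u} {w} uw p) vz = f u w uw ∷ path-closed-linked f p vz

∈-neighbours : ∀ (Adj : Adjacency n) {v w} → Adj v w ≡ true → w ∈ tabulate (Adj v)
∈-neighbours Adj {v} {w} vw = lookup⇒∈ (trans (lookup∘tabulate (Adj v) w) vw)

degree-two-neighbours : ∀ (Adj : Adjacency n) {v a b} → deg Adj v ≡ 2 → Adj v a ≡ true → Adj v b ≡ true →
  a ≢ b → ∀ {w} → Adj v w ≡ true → w ≡ a ⊎ w ≡ b
degree-two-neighbours Adj {v} {a} {b} deg≡2 va vb a≢b {w} vw with w ≟ a | w ≟ b
... | yes w≡a | _       = inj₁ w≡a
... | no _    | yes w≡b = inj₂ w≡b
... | no w≢a  | no w≢b  = contradiction (subst (3 ≤ℕ_) deg≡2 three≤deg) λ { (s≤s (s≤s ())) }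
  where
  three≤deg : 3 ≤ℕ deg Adj v
  three≤deg = 3≤∣p∣ (∈-neighbours Adj va) (∈-neighbours Adj vb) (∈-neighbours Adj vw) (a≢b ∘ sym) w≢a w≢b

module TreeProperties {U : Subset n} {Adj : Adjacency n} (T : IsTree U Adj) where
  open IsTree T

  adj⇒≢ : ∀ {a b} → Adj a b ≡ true → a ≢ b
  adj⇒≢ {a} ab refl = true≢false (trans (sym ab) (irrefl a))

  adj-sym : ∀ {a b} → Adj a b ≡ true → Adj b a ≡ true
  adj-sym {a} {b} ab = trans (symm b a) ab

  no-triangle : ∀ {a b c} → Adj a b ≡ true → Adj b c ≡ true → Adj c a ≡ true → ⊥
  no-triangle ab bc ca =
    acyclic (_ , _ ∷ _ ∷ [] , s≤s (s≤s z≤n) ,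
             ((adj⇒≢ ab ∷ adj⇒≢ (adj-sym ca) ∷ []) ∷ (adj⇒≢ bc ∷ []) ∷ [] ∷ []) ,
             ab ∷ bc ∷ ca ∷ [-])

  no-path-around-edge : ∀ {R : Adjacency n} → (∀ u v → R u v ≡ true → Adj u v ≡ true) →
    ∀ {u v xs} → Adj v u ≡ true → Path {R = R} u v xs → Unique (u ∷ xs) → 2 ≤ℕ length xs → ⊥
  no-path-around-edge R⊆Adj vu p uq 2≤len = acyclic (_ , _ , 2≤len , uq , path-closed-linked R⊆Adj p vu)

  cut-disconnects : ∀ {a b} → Adj a b ≡ true → ¬ Reach (cut Adj a b) a b
  cut-disconnects {a} {b} ab r with reach⇒path r
  ... | []        , end      , _  = adj⇒≢ ab refl
  ... | _ ∷ []    , ab′ ▹ end , _  = true≢false (trans (sym ab′) (cut-removes Adj a b (inj₁ (refl , refl))))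
  ... | _ ∷ _ ∷ _ , p        , uq = no-path-around-edge (cut⊆ Adj a b) (adj-sym ab) p uq (s≤s (s≤s z≤n))

  cut-separates : ∀ {a b x} → Adj a b ≡ true → Reach (cut Adj a b) a x → Reach (cut Adj a b) b x → ⊥
  cut-separates {a} {b} ab ax bx =
    cut-disconnects ab (reach-++ ax (reach-reverse (cut-sym Adj a b symm) bx))

  orientation-acyclic : ∀ {D : Adjacency n} → (∀ u v → D u v ≡ true → Adj u v ≡ true) →
    (∀ u v → D u v ≡ true → D v u ≡ false) → ∀ v → ¬ DPath D v v
  orientation-acyclic D⊆Adj antisym v (arc vv) = adj⇒≢ (D⊆Adj v v vv) refl
  orientation-acyclic D⊆Adj antisym v (_▸_ {w = w} vw p) with reach⇒path (dpath⇒reach p)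
  ... | []        , end      , _  = adj⇒≢ (D⊆Adj v w vw) refl
  ... | _ ∷ []    , wv ▹ end , _  = true≢false (trans (sym wv) (antisym v w vw))
  ... | _ ∷ _ ∷ _ , q        , uq = no-path-around-edge D⊆Adj (D⊆Adj v w vw) q uq (s≤s (s≤s z≤n))

record PrimedEdge (A : AugSet n) (u j : Fin n) : Set where
  field
    members : ∀ b → b ∈A A → b ≡ inj₁ u ⊎ b ≡ inj₁ j ⊎ b ≡ inj₂ j
    u∈A     : inj₁ u ∈A A
    j∈A     : inj₁ j ∈A A
    j′∈A    : inj₂ j ∈A A

cB-PrimedEdge : ∀ (D : Adjacency n) IJ {A u j} → u ≢ j → j ∈ IJ → PrimedEdge A u j → cB D IJ A ≡ D u j
cB-PrimedEdge D IJ {A} {u} {j} u≢j j∈IJ P with D u j in uj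
... | true = HasSink⇒cB D IJ A (inj₁ j , j∈A , parent)
  where
  open PrimedEdge P
  parent : ∀ b → b ∈A A → b ≢ inj₁ j → parB D IJ b (inj₁ j) ≡ true
  parent b b∈A b≢j with members b b∈A
  ... | inj₁ refl        = uj
  ... | inj₂ (inj₁ refl) = contradiction refl b≢j
  ... | inj₂ (inj₂ refl) = cong₂ _∧_ (≟-refl j) (∈⇒lookup j∈IJ)
... | false = cB-false D IJ A nonParent
  where
  open PrimedEdge P
  nonParent : ∀ a → a ∈A A → ∃[ b ] b ∈A A × b ≢ a × parB D IJ b a ≡ false
  nonParent a a∈A with members a a∈A
  ... | inj₁ refl        = inj₂ j , j′∈A , (λ ()) , cong (_∧ lookup IJ j) (≟-≢ (u≢j ∘ sym))
  ... | inj₂ (inj₁ refl) = inj₁ u , u∈A , (λ { refl → u≢j refl }) , uj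
  ... | inj₂ (inj₂ refl) = inj₁ u , u∈A , (λ ()) , refl

AdmissibleWeights : Adjacency n → Subset n → Weights (Adjacency n) → Set
AdmissibleWeights Adj J = All (λ e → 0ℚ ≤ℚ proj₁ e × IsAdmissibleDAG Adj J (proj₂ e))

sumW≡sumBy : ∀ (L : Weights (Adjacency n)) → sumW L ≡ sumBy proj₁ L
sumW≡sumBy []            = refl
sumW≡sumBy ((w , _) ∷ L) = cong (w +_) (sumW≡sumBy L)

combo≡sumBy : ∀ IJ (L : Weights (Adjacency n)) A → combo IJ L A ≡ sumBy (λ e → proj₁ e * cim (proj₂ e) IJ A) L
combo≡sumBy IJ []            A = refl
combo≡sumBy IJ ((w , D) ∷ L) A = cong (w * cim D IJ A +_) (combo≡sumBy IJ L A)

cim-cong : ∀ (D : Adjacency n) IJ A {D′ IJ′} → cB D IJ A ≡ cB D′ IJ′ A → cim D IJ A ≡ cim D′ IJ′ A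
cim-cong D IJ A = cong (λ b → if b then 1ℚ else 0ℚ)

Chain : Adjacency n → Fin n → Fin n → Fin n → Set
Chain D i j k = (D i j ≡ true × D j k ≡ true) ⊎ (D j i ≡ true × D k j ≡ true)

Chain-swap : ∀ {D : Adjacency n} {i j k} → Chain D i j k → Chain D k j i
Chain-swap = Sum.swap ∘ Sum.map Product.swap Product.swap

Chain-transport : ∀ {D D′ : Adjacency n} {i j k} →
  D i j ≡ D′ i j → D j k ≡ D′ j k → D j i ≡ D′ j i → D k j ≡ D′ k j → Chain D i j k → Chain D′ i j k
Chain-transport ij jk ji kj = Sum.map (Product.map (trans (sym ij)) (trans (sym jk)))
                                      (Product.map (trans (sym ji)) (trans (sym kj)))

reverse-arc : ∀ {Adj : Adjacency n} {J D} → IsAdmissibleDAG Adj J D →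
              ∀ {u v} → Adj u v ≡ true → D v u ≡ not (D u v)
reverse-arc adm {u} {v} uv with IsAdmissibleDAG.edges-arcs adm u v uv
... | inj₁ u→v rewrite u→v = IsAdmissibleDAG.antisym adm u v u→v
... | inj₂ v→u rewrite v→u | IsAdmissibleDAG.antisym adm v u v→u = refl

combo-PrimedEdge : ∀ IJ (L : Weights (Adjacency n)) {A u j} → u ≢ j → j ∈ IJ → PrimedEdge A u j →
                   combo IJ L A ≡ mass (λ D → D u j) L true
combo-PrimedEdge IJ L {A} {u} {j} u≢j j∈IJ P = trans (combo≡sumBy IJ L A) (sumBy-ext arc-weight L)
  where
  arc-weight : ∀ e → proj₁ e * cim (proj₂ e) IJ A ≡ when ⌊ proj₂ e u j Bool.≟ true ⌋ (proj₁ e)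
  arc-weight (w , D) rewrite cB-PrimedEdge D IJ u≢j j∈IJ P | ≟ᵇ-true (D u j) = *-indicator w (D u j)

-- The part on the s-side of j ∈ J, whose neighbours are s and f: in the paper's notation
-- Adjᵖ, Iᵖ, Jᵖ are T^s, I^s, J^s: T is cut at the edge j–f (Cut) and restricted to the
-- component W of s.
module Part {U : Subset n} {Adj : Adjacency n} {I J : Subset n} (GT : IsGluingTree U Adj I J)
  (j s f : Fin n) (j∈J : j ∈ J) (Cut : Adjacency n) (W : Subset n)
  (Cut⊆Adj : ∀ u v → Cut u v ≡ true → Adj u v ≡ true)
  (Cut-sym : ∀ u v → Cut u v ≡ true → Cut v u ≡ true)
  (Cut-jf : Cut j f ≡ false) (Cut-js : Cut j s ≡ true)
  (s∈W : s ∈ W) (j∈W : j ∈ W) (f∉W : f ∉ W)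
  (sj : Adj s j ≡ true) (fj : Adj f j ≡ true) (s≢f : s ≢ f) where

  open IsGluingTree GT
  open TreeProperties tree

  Adjᵖ : Adjacency n
  Adjᵖ = restrict Cut W

  Iᵖ Jᵖ IJᵖ IJ : Subset n
  Iᵖ  = partI I j W
  Jᵖ  = partJ J j W
  IJᵖ = Iᵖ ∪ Jᵖ
  IJ  = I ∪ J

  IJᵖ⊆IJ : IJᵖ ⊆ IJ
  IJᵖ⊆IJ {v} m with x∈p∪q⁻ Iᵖ Jᵖ m
  ... | inj₂ v∈Jᵖ = x∈p∪q⁺ (inj₂ (proj₁ (x∈p∩q⁻ J _ (proj₁ (x∈p∩q⁻ _ W v∈Jᵖ)))))
  ... | inj₁ v∈Iᵖ with x∈p∪q⁻ I ⁅ j ⁆ (proj₁ (x∈p∩q⁻ _ W v∈Iᵖ))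
  ...   | inj₁ v∈I = x∈p∪q⁺ (inj₁ v∈I)
  ...   | inj₂ v∈j rewrite x∈⁅y⁆⇒x≡y j v∈j = x∈p∪q⁺ (inj₂ j∈J)

  J∖j∩W⊆Jᵖ : ∀ {v} → v ∈ J → v ≢ j → v ∈ W → v ∈ Jᵖ
  J∖j∩W⊆Jᵖ v∈J v≢j v∈W = x∈p∩q⁺ (x∈p∩q⁺ (v∈J , x∉p⇒x∈∁p (x≢y⇒x∉⁅y⁆ v≢j)) , v∈W)

  IJ∩W⊆IJᵖ : ∀ {v} → v ∈ IJ → v ∈ W → v ∈ IJᵖ
  IJ∩W⊆IJᵖ {v} m v∈W with x∈p∪q⁻ I J m | v ≟ j
  ... | inj₁ v∈I | _        = x∈p∪q⁺ (inj₁ (x∈p∩q⁺ (x∈p∪q⁺ (inj₁ v∈I) , v∈W)))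
  ... | inj₂ _   | yes refl = x∈p∪q⁺ (inj₁ (x∈p∩q⁺ (x∈p∪q⁺ (inj₂ (x∈⁅x⁆ j)) , v∈W)))
  ... | inj₂ v∈J | no v≢j   = x∈p∪q⁺ (inj₂ (J∖j∩W⊆Jᵖ v∈J v≢j v∈W))

  j∈IJᵖ : j ∈ IJᵖ
  j∈IJᵖ = IJ∩W⊆IJᵖ (x∈p∪q⁺ (inj₂ j∈J)) j∈W

  Adjᵖ⊆Adj : ∀ u v → Adjᵖ u v ≡ true → Adj u v ≡ true
  Adjᵖ⊆Adj u v e = Cut⊆Adj u v (restrict⊆ Cut W u v e)

  Adjᵖ-inside : ∀ u v → Adjᵖ u v ≡ true → u ∈ W × v ∈ W
  Adjᵖ-inside = restrict-inside Cut W

  Adjᵖ-sym : ∀ u v → Adjᵖ u v ≡ true → Adjᵖ v u ≡ true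
  Adjᵖ-sym u v e = let u∈W , v∈W = Adjᵖ-inside u v e in
    restrict-intro Cut W (Cut-sym u v (restrict⊆ Cut W u v e)) v∈W u∈W

  star-lift : ∀ A → IsStar Adjᵖ IJᵖ A → IsStar Adj IJ A
  star-lift A (c , c∈A , spoke , size) = c , c∈A , (λ w w∈A w≢c → lift c w (spoke w w∈A w≢c)) , size
    where
    lift : ∀ c w → AugAdj Adjᵖ IJᵖ c w → AugAdj Adj IJ c w
    lift (inj₁ c) (inj₁ w) e         = Adjᵖ⊆Adj c w e
    lift (inj₁ c) (inj₂ w) (c≡w , m) = c≡w , IJᵖ⊆IJ m
    lift (inj₂ c) (inj₁ w) (c≡w , m) = c≡w , IJᵖ⊆IJ m

  module Star {A : AugSet n} (S : IsStar Adjᵖ IJᵖ A) where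

    centre : AugV n
    centre = proj₁ S

    spoke : ∀ w → w ∈A A → w ≢ centre → AugAdj Adjᵖ IJᵖ centre w
    spoke = proj₁ (proj₂ (proj₂ S))

    misses-s-j-f : inj₁ s ∈A A → inj₁ j ∈A A → inj₁ f ∈A A → ⊥
    misses-s-j-f s∈A j∈A f∈A = go centre spoke
      where
      go : ∀ c → (∀ w → w ∈A A → w ≢ c → AugAdj Adjᵖ IJᵖ c w) → ⊥
      go (inj₂ v) sp with sp (inj₁ s) s∈A (λ ()) | sp (inj₁ j) j∈A (λ ())
      ... | refl , _ | refl , _ = adj⇒≢ sj refl
      go (inj₁ x) sp with x ≟ j | x ≟ s | x ≟ f
      ... | yes refl | _        | _        =
        true≢false (trans (sym (restrict⊆ Cut W j f (sp (inj₁ f) f∈A λ { refl → adj⇒≢ fj refl }))) Cut-jf)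
      ... | no _     | yes refl | _        =
        no-triangle (Adjᵖ⊆Adj s f (sp (inj₁ f) f∈A λ { refl → s≢f refl })) fj (adj-sym sj)
      ... | no _     | no _     | yes refl =
        f∉W (proj₁ (Adjᵖ-inside f j (sp (inj₁ j) j∈A λ { refl → adj⇒≢ fj refl })))
      ... | no x≢j   | no x≢s   | no _     =
        no-triangle (Adjᵖ⊆Adj x s (sp (inj₁ s) s∈A λ { refl → x≢s refl })) sj
                    (adj-sym (Adjᵖ⊆Adj x j (sp (inj₁ j) j∈A λ { refl → x≢j refl })))

    old-pair : ∀ {a b} → inj₁ a ∈A A → inj₁ b ∈A A → a ≢ b → Adjᵖ b a ≡ true ⊎ Adj b a ≡ false
    old-pair {a} {b} a∈A b∈A a≢b = go centre spoke
      where
      go : ∀ c → (∀ w → w ∈A A → w ≢ c → AugAdj Adjᵖ IJᵖ c w) → Adjᵖ b a ≡ true ⊎ Adj b a ≡ false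
      go (inj₂ v) sp with sp (inj₁ a) a∈A (λ ()) | sp (inj₁ b) b∈A (λ ())
      ... | refl , _ | refl , _ = contradiction refl a≢b
      go (inj₁ x) sp with x ≟ a | x ≟ b
      ... | yes refl | _        = inj₁ (Adjᵖ-sym x b (sp (inj₁ b) b∈A λ { refl → a≢b refl }))
      ... | no _     | yes refl = inj₁ (sp (inj₁ a) a∈A λ { refl → a≢b refl })
      ... | no x≢a   | no x≢b   = inj₂ (¬-not λ ba →
        no-triangle (Adjᵖ⊆Adj x b (sp (inj₁ b) b∈A λ { refl → x≢b refl })) ba
                    (adj-sym (Adjᵖ⊆Adj x a (sp (inj₁ a) a∈A λ { refl → x≢a refl }))))

    primed∈IJᵖ : ∀ {v} → inj₂ v ∈A A → inj₁ v ∈A A → v ∈ IJᵖ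
    primed∈IJᵖ {v} v′∈A v∈A = go centre spoke
      where
      go : ∀ c → (∀ w → w ∈A A → w ≢ c → AugAdj Adjᵖ IJᵖ c w) → v ∈ IJᵖ
      go (inj₁ x) sp = proj₂ (sp (inj₂ v) v′∈A (λ ()))
      go (inj₂ x) sp with x ≟ v
      ... | yes refl = proj₂ (sp (inj₁ v) v∈A (λ ()))
      ... | no x≢v   = ⊥-elim (sp (inj₂ v) v′∈A (λ { refl → x≢v refl }))

  -- Two old vertices of a part star are joined by a star edge or, T having no triangles, not
  -- adjacent in T at all; so parenthood inside the star only involves edges of the part.
  cB-agree : ∀ (E E′ : Adjacency n) →
    (∀ u v → E u v ≡ true → Adj u v ≡ true) → (∀ u v → E′ u v ≡ true → Adj u v ≡ true) →
    (∀ u v → Adjᵖ u v ≡ true → E u v ≡ E′ u v) →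
    ∀ A → IsStar Adjᵖ IJᵖ A → cB E IJ A ≡ cB E′ IJᵖ A
  cB-agree E E′ E⊆Adj E′⊆Adj agree A S = cB-cong E IJ E′ IJᵖ A same
    where
    open Star S
    same : ∀ a b → a ∈A A → b ∈A A → b ≢ a → parB E IJ b a ≡ parB E′ IJᵖ b a
    same (inj₁ a) (inj₁ b) a∈A b∈A b≢a with old-pair a∈A b∈A (λ { refl → b≢a refl })
    ... | inj₁ ba  = agree b a ba
    ... | inj₂ ¬ba = trans (¬-not λ e → true≢false (trans (sym (E⊆Adj b a e)) ¬ba))
                           (sym (¬-not λ e → true≢false (trans (sym (E′⊆Adj b a e)) ¬ba)))
    same (inj₁ a) (inj₂ v) a∈A v′∈A _ with v ≟ a
    ... | no _     = refl
    ... | yes refl = let m = primed∈IJᵖ v′∈A a∈A in trans (∈⇒lookup (IJᵖ⊆IJ m)) (sym (∈⇒lookup m))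
    same (inj₂ _) (inj₁ _) _ _ _ = refl
    same (inj₂ _) (inj₂ _) _ _ _ = refl

  PrimedEdge⇒star : ∀ {A} → PrimedEdge A s j → IsStar Adjᵖ IJᵖ A
  PrimedEdge⇒star {A} P = inj₁ j , j∈A , spoke , size
    where
    open PrimedEdge P
    spoke : ∀ w → w ∈A A → w ≢ inj₁ j → AugAdj Adjᵖ IJᵖ (inj₁ j) w
    spoke w w∈A w≢j with members w w∈A
    ... | inj₁ refl        = restrict-intro Cut W Cut-js j∈W s∈W
    ... | inj₂ (inj₁ refl) = contradiction refl w≢j
    ... | inj₂ (inj₂ refl) = refl , j∈IJᵖ
    size : 3 ≤ℕ sizeA A
    size = ℕ.+-mono-≤ {2} {_} {1} (2≤∣p∣ u∈A j∈A (adj⇒≢ sj ∘ sym)) (1≤∣p∣ j′∈A)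

  star-at-old : ∀ {A c} → inj₁ c ∈A A → (∀ w → w ∈A A → w ≢ inj₁ c → AugAdj Adj IJ (inj₁ c) w) →
    3 ≤ℕ sizeA A → (∀ {x} → inj₁ x ∈A A → Adj c x ≡ true → Adjᵖ c x ≡ true) → (c ∈ IJ → c ∈ W) →
    IsStar Adjᵖ IJᵖ A
  star-at-old {A} {c} c∈A spoke size edges c∈W = inj₁ c , c∈A , spokeᵖ , size
    where
    spokeᵖ : ∀ w → w ∈A A → w ≢ inj₁ c → AugAdj Adjᵖ IJᵖ (inj₁ c) w
    spokeᵖ (inj₁ x) x∈A x≢c = edges x∈A (spoke (inj₁ x) x∈A x≢c)
    spokeᵖ (inj₂ x) x∈A x≢c with spoke (inj₂ x) x∈A x≢c
    ... | refl , c∈IJ = refl , IJ∩W⊆IJᵖ c∈IJ (c∈W c∈IJ)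

  star-at-primed : ∀ {A v} → inj₂ v ∈A A → (∀ w → w ∈A A → w ≢ inj₂ v → AugAdj Adj IJ (inj₂ v) w) →
    3 ≤ℕ sizeA A → (v ∈ IJ → v ∈ W) → IsStar Adjᵖ IJᵖ A
  star-at-primed {A} {v} v′∈A spoke size v∈W = inj₂ v , v′∈A , spokeᵖ , size
    where
    spokeᵖ : ∀ w → w ∈A A → w ≢ inj₂ v → AugAdj Adjᵖ IJᵖ (inj₂ v) w
    spokeᵖ (inj₁ x) x∈A x≢v with spoke (inj₁ x) x∈A x≢v
    ... | refl , v∈IJ = refl , IJ∩W⊆IJᵖ v∈IJ (v∈W v∈IJ)
    spokeᵖ (inj₂ x) x∈A x≢v = spoke (inj₂ x) x∈A x≢v

  restrictDAG : Adjacency n → Adjacency n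
  restrictDAG D u v = D u v ∧ Adjᵖ u v

  restrictDAG-admissible : ∀ {D} → IsAdmissibleDAG Adj J D → IsAdmissibleDAG Adjᵖ Jᵖ (restrictDAG D)
  restrictDAG-admissible {D} adm = record
    { arcs-edges = λ u v → ∧-conicalʳ (D u v) _
    ; edges-arcs = edges-arcs′
    ; antisym    = λ u v e → cong (_∧ Adjᵖ v u) (antisym u v (∧-conicalˡ (D u v) _ e))
    ; acyclic    = λ v → acyclic v ∘ unrestrict
    ; J-chain    = J-chain′
    }
    where
    open IsAdmissibleDAG adm
    unrestrict : ∀ {a b} → DPath (restrictDAG D) a b → DPath D a b
    unrestrict (arc e) = arc (∧-conicalˡ _ _ e)
    unrestrict (e ▸ p) = ∧-conicalˡ _ _ e ▸ unrestrict p
    edges-arcs′ : ∀ u v → Adjᵖ u v ≡ true → restrictDAG D u v ≡ true ⊎ restrictDAG D v u ≡ true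
    edges-arcs′ u v uv with edges-arcs u v (Adjᵖ⊆Adj u v uv)
    ... | inj₁ d = inj₁ (cong₂ _∧_ d uv)
    ... | inj₂ d = inj₂ (cong₂ _∧_ d (Adjᵖ-sym u v uv))
    J-chain′ : ∀ j′ i′ k′ → j′ ∈ Jᵖ → i′ ≢ k′ → Adjᵖ i′ j′ ≡ true → Adjᵖ k′ j′ ≡ true →
               Chain (restrictDAG D) i′ j′ k′
    J-chain′ j′ i′ k′ m i′≢k′ ij kj
      with J-chain j′ i′ k′ (proj₁ (x∈p∩q⁻ J _ (proj₁ (x∈p∩q⁻ _ W m)))) i′≢k′
                 (Adjᵖ⊆Adj i′ j′ ij) (Adjᵖ⊆Adj k′ j′ kj)
    ... | inj₁ (a , b) = inj₁ (cong₂ _∧_ a ij , cong₂ _∧_ b (Adjᵖ-sym k′ j′ kj))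
    ... | inj₂ (a , b) = inj₂ (cong₂ _∧_ a (Adjᵖ-sym i′ j′ ij) , cong₂ _∧_ b kj)

  cim-restrictDAG : ∀ {D} → IsAdmissibleDAG Adj J D → ∀ A → IsStar Adjᵖ IJᵖ A →
                    cim D IJ A ≡ cim (restrictDAG D) IJᵖ A
  cim-restrictDAG {D} adm A S = cim-cong D IJ A {restrictDAG D} {IJᵖ}
    (cB-agree D (restrictDAG D) (IsAdmissibleDAG.arcs-edges adm)
              (λ u v e → Adjᵖ⊆Adj u v (∧-conicalʳ (D u v) _ e))
              (λ u v uv → sym (trans (cong (D u v ∧_) uv) (∧-identityʳ (D u v)))) A S)

  project : ∀ {Keep x} → InCIMon Adj I J Keep x → (∀ A → IsStar Adjᵖ IJᵖ A → Keep A) → InCIM Adjᵖ Iᵖ Jᵖ x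
  project (L , adm , total , agrees) kept =
    restricted L , restricted-admissible adm , trans (sumW-restricted L) total ,
    λ A S _ → trans (agrees A (star-lift A S) (kept A S)) (combo-restricted A S adm)
    where
    restricted : Weights (Adjacency n) → Weights (Adjacency n)
    restricted = Data.List.map (Product.map₂ restrictDAG)
    restricted-admissible : ∀ {L} → AdmissibleWeights Adj J L → AdmissibleWeights Adjᵖ Jᵖ (restricted L)
    restricted-admissible []               = []
    restricted-admissible ((0≤w , a) ∷ as) = (0≤w , restrictDAG-admissible a) ∷ restricted-admissible as
    sumW-restricted : ∀ L → sumW (restricted L) ≡ sumW L
    sumW-restricted []            = refl
    sumW-restricted ((w , _) ∷ L) = cong (w +_) (sumW-restricted L)
    combo-restricted : ∀ A → IsStar Adjᵖ IJᵖ A → ∀ {L} → AdmissibleWeights Adj J L →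
                       combo IJ L A ≡ combo IJᵖ (restricted L) A
    combo-restricted A S []                             = refl
    combo-restricted A S {(w , D) ∷ _} ((_ , a) ∷ as) =
      cong₂ _+_ (cong (w *_) (cim-restrictDAG a A S)) (combo-restricted A S as)

module Parting {U : Subset n} {Adj : Adjacency n} {I J : Subset n} (GT : IsGluingTree U Adj I J)
  (j i k : Fin n) (j∈J : j ∈ J) (i≢k : i ≢ k) (ij : Adj i j ≡ true) (kj : Adj k j ≡ true)
  (Uⁱ Uᵏ : Subset n)
  (Uⁱ-spec : ∀ v → (v ∈ Uⁱ) ⇔ Reach (cut Adj j k) i v)
  (Uᵏ-spec : ∀ v → (v ∈ Uᵏ) ⇔ Reach (cut Adj i j) k v) where

  open IsGluingTree GT
  open IsTree tree
  open TreeProperties tree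

  Cⁱ Cᵏ : Adjacency n
  Cⁱ = cut Adj j k
  Cᵏ = cut Adj i j

  ji : Adj j i ≡ true
  ji = adj-sym ij

  jk : Adj j k ≡ true
  jk = adj-sym kj

  i≢j : i ≢ j
  i≢j = adj⇒≢ ij

  k≢j : k ≢ j
  k≢j = adj⇒≢ kj

  neighbours-of-j : ∀ {w} → Adj j w ≡ true → w ≡ i ⊎ w ≡ k
  neighbours-of-j = degree-two-neighbours Adj (J-degree2 j j∈J) ji jk i≢k

  Cⁱ-ij : Cⁱ i j ≡ true
  Cⁱ-ij = trans (cut-keeps Adj j k λ { (inj₁ (i≡j , _)) → i≢j i≡j ; (inj₂ (i≡k , _)) → i≢k i≡k }) ij

  Cⁱ-ji : Cⁱ j i ≡ true
  Cⁱ-ji = cut-sym Adj j k symm i j Cⁱ-ij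

  Cᵏ-kj : Cᵏ k j ≡ true
  Cᵏ-kj = trans (cut-keeps Adj i j λ { (inj₁ (k≡i , _)) → i≢k (sym k≡i) ; (inj₂ (k≡j , _)) → k≢j k≡j }) kj

  Cᵏ-jk : Cᵏ j k ≡ true
  Cᵏ-jk = cut-sym Adj i j symm k j Cᵏ-kj

  ∈Uⁱ⇒ : ∀ {v} → v ∈ Uⁱ → Reach Cⁱ i v
  ∈Uⁱ⇒ {v} = Equivalence.to (Uⁱ-spec v)

  ⇒∈Uⁱ : ∀ {v} → Reach Cⁱ i v → v ∈ Uⁱ
  ⇒∈Uⁱ {v} = Equivalence.from (Uⁱ-spec v)

  ∈Uᵏ⇒ : ∀ {v} → v ∈ Uᵏ → Reach Cᵏ k v
  ∈Uᵏ⇒ {v} = Equivalence.to (Uᵏ-spec v)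

  ⇒∈Uᵏ : ∀ {v} → Reach Cᵏ k v → v ∈ Uᵏ
  ⇒∈Uᵏ {v} = Equivalence.from (Uᵏ-spec v)

  i∈Uⁱ : i ∈ Uⁱ
  i∈Uⁱ = ⇒∈Uⁱ here

  j∈Uⁱ : j ∈ Uⁱ
  j∈Uⁱ = ⇒∈Uⁱ (step Cⁱ-ij here)

  k∈Uᵏ : k ∈ Uᵏ
  k∈Uᵏ = ⇒∈Uᵏ here

  j∈Uᵏ : j ∈ Uᵏ
  j∈Uᵏ = ⇒∈Uᵏ (step Cᵏ-kj here)

  Uⁱ-closed : ∀ {u w} → u ∈ Uⁱ → Cⁱ u w ≡ true → w ∈ Uⁱ
  Uⁱ-closed u∈ uw = ⇒∈Uⁱ (reach-snoc (∈Uⁱ⇒ u∈) uw)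

  Uᵏ-closed : ∀ {u w} → u ∈ Uᵏ → Cᵏ u w ≡ true → w ∈ Uᵏ
  Uᵏ-closed u∈ uw = ⇒∈Uᵏ (reach-snoc (∈Uᵏ⇒ u∈) uw)

  Cⁱ∩Cᵏ : Adjacency n
  Cⁱ∩Cᵏ u v = Cⁱ u v ∧ Cᵏ u v

  j-isolated : ∀ {x} → Reach Cⁱ∩Cᵏ j x → x ≡ j
  j-isolated here = refl
  j-isolated (step {w = w} e _) with neighbours-of-j (cut⊆ Adj j k j w (∧-conicalˡ _ _ e))
  ... | inj₁ refl =
    contradiction (trans (sym (∧-conicalʳ (Cⁱ j i) _ e)) (cut-removes Adj i j (inj₂ (refl , refl)))) true≢false
  ... | inj₂ refl =
    contradiction (trans (sym (∧-conicalˡ _ _ e)) (cut-removes Adj j k (inj₁ (refl , refl)))) true≢false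

  Cᵏ-walk : ∀ {y x} → Reach Cᵏ y x → x ≢ j → Reach Cⁱ∩Cᵏ y x ⊎ Reach Cⁱ k x
  Cᵏ-walk here _ = inj₁ here
  Cᵏ-walk {y} (step {w = w} yw r) x≢j with Cᵏ-walk r x≢j
  ... | inj₂ kx = inj₂ kx
  ... | inj₁ wx with Cⁱ y w Bool.≟ true
  ...   | yes yw′ = inj₁ (step (cong₂ _∧_ yw′ yw) wx)
  ...   | no ¬yw′ with cut-false⇒SameEdge Adj j k y w (cut⊆ Adj i j y w yw) (¬-not ¬yw′)
  ...     | inj₁ (refl , refl) = inj₂ (reach-map (λ u v → ∧-conicalˡ _ _) wx)
  ...     | inj₂ (refl , refl) = contradiction (j-isolated wx) x≢j

  Uⁱ∩Uᵏ≡j : ∀ {x} → x ∈ Uⁱ → x ∈ Uᵏ → x ≡ j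
  Uⁱ∩Uᵏ≡j {x} x∈Uⁱ x∈Uᵏ with x ≟ j
  ... | yes x≡j = x≡j
  ... | no  x≢j = ⊥-elim (cut-separates jk (step Cⁱ-ji (∈Uⁱ⇒ x∈Uⁱ)) kx)
    where
    kx : Reach Cⁱ k x
    kx with Cᵏ-walk (∈Uᵏ⇒ x∈Uᵏ) x≢j
    ... | inj₁ q = reach-map (λ u v → ∧-conicalˡ _ _) q
    ... | inj₂ q = q

  k∉Uⁱ : k ∉ Uⁱ
  k∉Uⁱ k∈Uⁱ = k≢j (Uⁱ∩Uᵏ≡j k∈Uⁱ k∈Uᵏ)

  i∉Uᵏ : i ∉ Uᵏ
  i∉Uᵏ i∈Uᵏ = i≢j (Uⁱ∩Uᵏ≡j i∈Uⁱ i∈Uᵏ)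

  Uⁱ∪Uᵏ : ∀ {u} → u ∈ U → u ∈ Uⁱ ⊎ u ∈ Uᵏ
  Uⁱ∪Uᵏ u∈U = go (connected i _ (proj₁ (inside i j ij)) u∈U) (inj₁ i∈Uⁱ)
    where
    go : ∀ {s u} → Reach Adj s u → s ∈ Uⁱ ⊎ s ∈ Uᵏ → u ∈ Uⁱ ⊎ u ∈ Uᵏ
    go here m = m
    go {s} (step {w = w} sw r) (inj₁ s∈) with Cⁱ s w Bool.≟ true
    ... | yes sw′ = go r (inj₁ (Uⁱ-closed s∈ sw′))
    ... | no ¬sw′ with cut-false⇒SameEdge Adj j k s w sw (¬-not ¬sw′)
    ...   | inj₁ (refl , refl) = go r (inj₂ k∈Uᵏ)
    ...   | inj₂ (refl , refl) = go r (inj₂ j∈Uᵏ)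
    go {s} (step {w = w} sw r) (inj₂ s∈) with Cᵏ s w Bool.≟ true
    ... | yes sw′ = go r (inj₂ (Uᵏ-closed s∈ sw′))
    ... | no ¬sw′ with cut-false⇒SameEdge Adj i j s w sw (¬-not ¬sw′)
    ...   | inj₁ (refl , refl) = go r (inj₁ j∈Uⁱ)
    ...   | inj₂ (refl , refl) = go r (inj₁ i∈Uⁱ)

  ∉Uⁱ⇒∈Uᵏ : ∀ {v} → v ∈ U → v ∉ Uⁱ → v ∈ Uᵏ
  ∉Uⁱ⇒∈Uᵏ v∈U v∉Uⁱ with Uⁱ∪Uᵏ v∈U
  ... | inj₁ v∈Uⁱ = contradiction v∈Uⁱ v∉Uⁱ
  ... | inj₂ v∈Uᵏ = v∈Uᵏ

  module Pⁱ = Part GT j i k j∈J Cⁱ Uⁱ (cut⊆ Adj j k) (cut-sym Adj j k symm)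
                   (cut-removes Adj j k (inj₁ (refl , refl))) Cⁱ-ji i∈Uⁱ j∈Uⁱ k∉Uⁱ ij kj i≢k
  module Pᵏ = Part GT j k i j∈J Cᵏ Uᵏ (cut⊆ Adj i j) (cut-sym Adj i j symm)
                   (cut-removes Adj i j (inj₂ (refl , refl))) Cᵏ-jk k∈Uᵏ j∈Uᵏ i∉Uᵏ kj ij (i≢k ∘ sym)

  Adjⁱ Adjᵏ : Adjacency n
  Adjⁱ = Pⁱ.Adjᵖ
  Adjᵏ = Pᵏ.Adjᵖ

  Adjⁱ∪Adjᵏ : ∀ u v → Adj u v ≡ true → Adjⁱ u v ≡ true ⊎ Adjᵏ u v ≡ true
  Adjⁱ∪Adjᵏ u v uv with Uⁱ∪Uᵏ (proj₁ (inside u v uv))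
  ... | inj₁ u∈ with Cⁱ u v Bool.≟ true
  ...   | yes uv′ = inj₁ (restrict-intro Cⁱ Uⁱ uv′ u∈ (Uⁱ-closed u∈ uv′))
  ...   | no ¬uv′ with cut-false⇒SameEdge Adj j k u v uv (¬-not ¬uv′)
  ...     | inj₁ (refl , refl) = inj₂ (restrict-intro Cᵏ Uᵏ Cᵏ-jk j∈Uᵏ k∈Uᵏ)
  ...     | inj₂ (refl , refl) = inj₂ (restrict-intro Cᵏ Uᵏ Cᵏ-kj k∈Uᵏ j∈Uᵏ)
  Adjⁱ∪Adjᵏ u v uv | inj₂ u∈ with Cᵏ u v Bool.≟ true
  ...   | yes uv′ = inj₂ (restrict-intro Cᵏ Uᵏ uv′ u∈ (Uᵏ-closed u∈ uv′))
  ...   | no ¬uv′ with cut-false⇒SameEdge Adj i j u v uv (¬-not ¬uv′)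
  ...     | inj₁ (refl , refl) = inj₁ (restrict-intro Cⁱ Uⁱ Cⁱ-ij i∈Uⁱ j∈Uⁱ)
  ...     | inj₂ (refl , refl) = inj₁ (restrict-intro Cⁱ Uⁱ Cⁱ-ji j∈Uⁱ i∈Uⁱ)

  Adjⁱ∩Adjᵏ : ∀ u v → Adjⁱ u v ≡ true → Adjᵏ u v ≡ true → ⊥
  Adjⁱ∩Adjᵏ u v uvⁱ uvᵏ with Pⁱ.Adjᵖ-inside u v uvⁱ | Pᵏ.Adjᵖ-inside u v uvᵏ
  ... | u∈Uⁱ , v∈Uⁱ | u∈Uᵏ , v∈Uᵏ with Uⁱ∩Uᵏ≡j u∈Uⁱ u∈Uᵏ | Uⁱ∩Uᵏ≡j v∈Uⁱ v∈Uᵏ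
  ...   | refl | refl = adj⇒≢ (Pⁱ.Adjᵖ⊆Adj u v uvⁱ) refl

  IJ : Subset n
  IJ = I ∪ J

  Triple : Subset n
  Triple = fromList (i ∷ j ∷ k ∷ [])

  Aᵢⱼₖ Aᵢⱼₖ′ Aᵢⱼ′ Aⱼₖ′ : AugSet n
  Aᵢⱼₖ  = setA (i ∷ j ∷ k ∷ []) []
  Aᵢⱼₖ′ = setA (i ∷ j ∷ k ∷ []) (j ∷ [])
  Aᵢⱼ′  = setA (i ∷ j ∷ []) (j ∷ [])
  Aⱼₖ′  = setA (j ∷ k ∷ []) (j ∷ [])

  i∈Triple : i ∈ Triple
  i∈Triple = ∈-fromList⁺ (i ∷ j ∷ k ∷ []) (here refl)

  j∈Triple : j ∈ Triple
  j∈Triple = ∈-fromList⁺ (i ∷ j ∷ k ∷ []) (there (here refl))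

  k∈Triple : k ∈ Triple
  k∈Triple = ∈-fromList⁺ (i ∷ j ∷ k ∷ []) (there (there (here refl)))

  Triple-star : ∀ Y → (∀ {v} → v ∈ Y → v ≡ j) → IsStar Adj IJ (Triple , Y)
  Triple-star Y Y⊆j = inj₁ j , j∈Triple , spoke , size
    where
    spoke : ∀ w → w ∈A (Triple , Y) → w ≢ inj₁ j → AugAdj Adj IJ (inj₁ j) w
    spoke (inj₁ v) v∈ v≢j with ∈-fromList⁻ (i ∷ j ∷ k ∷ []) v∈
    ... | here refl                 = ji
    ... | there (here refl)         = contradiction refl v≢j
    ... | there (there (here refl)) = jk
    spoke (inj₂ v) v∈ _ rewrite Y⊆j v∈ = refl , x∈p∪q⁺ (inj₂ j∈J)
    size : 3 ≤ℕ sizeA (Triple , Y)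
    size = ℕ.≤-trans (3≤∣p∣ i∈Triple j∈Triple k∈Triple (i≢j ∘ sym) (i≢k ∘ sym) k≢j)
                     (ℕ.m≤m+n ∣ Triple ∣ ∣ Y ∣)

  Triple-no-sink : ∀ {D} → IsAdmissibleDAG Adj J D → ∀ Y → cB D IJ (Triple , Y) ≡ false
  Triple-no-sink {D} adm Y = cB-false D IJ (Triple , Y) nonParent
    where
    open IsAdmissibleDAG adm
    A : AugSet n
    A = Triple , Y
    nonParent : ∀ a → a ∈A A → ∃[ b ] b ∈A A × b ≢ a × parB D IJ b a ≡ false
    nonParent (inj₂ v) _ = inj₁ i , i∈Triple , (λ ()) , refl
    nonParent (inj₁ v) v∈ with ∈-fromList⁻ (i ∷ j ∷ k ∷ []) v∈
    ... | here refl = inj₁ k , k∈Triple , (λ { refl → i≢k refl }) ,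
                      ¬-not (λ ki → no-triangle (arcs-edges k i ki) ij jk)
    ... | there (there (here refl)) = inj₁ i , i∈Triple , (λ { refl → i≢k refl }) ,
                      ¬-not (λ ik → no-triangle (arcs-edges i k ik) kj ji)
    ... | there (here refl) with J-chain j i k j∈J i≢k ij kj
    ...   | inj₁ (_ , j→k) = inj₁ k , k∈Triple , (λ { refl → k≢j refl }) , antisym j k j→k
    ...   | inj₂ (j→i , _) = inj₁ i , i∈Triple , (λ { refl → i≢j refl }) , antisym j i j→i

  combo-no-sink : ∀ {A L} → (∀ {D} → IsAdmissibleDAG Adj J D → cB D IJ A ≡ false) →
                  AdmissibleWeights Adj J L → combo IJ L A ≡ 0ℚ
  combo-no-sink                   no-sink []             = refl
  combo-no-sink {A} {(w , D) ∷ _} no-sink ((_ , a) ∷ as)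
    rewrite no-sink a | combo-no-sink {A} no-sink as = trans (+-identityʳ _) (*-zeroʳ w)

  Triple-vanishes : ∀ {x} → InCIM Adj I J x → ∀ Y → (∀ {v} → v ∈ Y → v ≡ j) → x (Triple , Y) ≡ 0ℚ
  Triple-vanishes (L , adm , _ , agrees) Y Y⊆j =
    trans (agrees _ (Triple-star Y Y⊆j) tt) (combo-no-sink (λ a → Triple-no-sink a Y) adm)

  triple-coordinates-vanish : ∀ {x} → InCIM Adj I J x → x Aᵢⱼₖ ≡ 0ℚ × x Aᵢⱼₖ′ ≡ 0ℚ
  triple-coordinates-vanish x∈ =
    Triple-vanishes x∈ Subset.⊥ (λ m → contradiction m ∉⊥) ,
    Triple-vanishes x∈ (fromList (j ∷ [])) (singleton⁻ ∘ ∈-fromList⁻ (j ∷ []))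

  PrimedEdge-ij : PrimedEdge Aᵢⱼ′ i j
  PrimedEdge-ij = record
    { members = members
    ; u∈A     = ∈-fromList⁺ (i ∷ j ∷ []) (here refl)
    ; j∈A     = ∈-fromList⁺ (i ∷ j ∷ []) (there (here refl))
    ; j′∈A    = ∈-fromList⁺ (j ∷ []) (here refl)
    }
    where
    members : ∀ b → b ∈A Aᵢⱼ′ → b ≡ inj₁ i ⊎ b ≡ inj₁ j ⊎ b ≡ inj₂ j
    members (inj₁ v) m with ∈-fromList⁻ (i ∷ j ∷ []) m
    ... | here refl         = inj₁ refl
    ... | there (here refl) = inj₂ (inj₁ refl)
    members (inj₂ v) m rewrite singleton⁻ (∈-fromList⁻ (j ∷ []) m) = inj₂ (inj₂ refl)

  PrimedEdge-kj : PrimedEdge Aⱼₖ′ k j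
  PrimedEdge-kj = record
    { members = members
    ; u∈A     = ∈-fromList⁺ (j ∷ k ∷ []) (there (here refl))
    ; j∈A     = ∈-fromList⁺ (j ∷ k ∷ []) (here refl)
    ; j′∈A    = ∈-fromList⁺ (j ∷ []) (here refl)
    }
    where
    members : ∀ b → b ∈A Aⱼₖ′ → b ≡ inj₁ k ⊎ b ≡ inj₁ j ⊎ b ≡ inj₂ j
    members (inj₁ v) m with ∈-fromList⁻ (j ∷ k ∷ []) m
    ... | here refl         = inj₂ (inj₁ refl)
    ... | there (here refl) = inj₁ refl
    members (inj₂ v) m rewrite singleton⁻ (∈-fromList⁻ (j ∷ []) m) = inj₂ (inj₂ refl)

  j∈IJ : j ∈ IJ
  j∈IJ = x∈p∪q⁺ (inj₂ j∈J)

  cim-ij+cim-kj : ∀ {D} → IsAdmissibleDAG Adj J D → cim D IJ Aᵢⱼ′ + cim D IJ Aⱼₖ′ ≡ 1ℚ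
  cim-ij+cim-kj {D} adm
    rewrite cB-PrimedEdge D IJ i≢j j∈IJ PrimedEdge-ij | cB-PrimedEdge D IJ k≢j j∈IJ PrimedEdge-kj
    with IsAdmissibleDAG.J-chain adm j i k j∈J i≢k ij kj
  ... | inj₁ (i→j , j→k) rewrite i→j | IsAdmissibleDAG.antisym adm j k j→k = refl
  ... | inj₂ (j→i , k→j) rewrite k→j | IsAdmissibleDAG.antisym adm j i j→i = refl

  combo-ij+combo-kj : ∀ {L} → AdmissibleWeights Adj J L → combo IJ L Aᵢⱼ′ + combo IJ L Aⱼₖ′ ≡ sumW L
  combo-ij+combo-kj []                              = refl
  combo-ij+combo-kj {(w , D) ∷ L} ((_ , adm) ∷ as) = begin
    (w * cim D IJ Aᵢⱼ′ + combo IJ L Aᵢⱼ′) + (w * cim D IJ Aⱼₖ′ + combo IJ L Aⱼₖ′)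
      ≡⟨ solve 5 (λ w a b X Y → (w :* a :+ X) :+ (w :* b :+ Y) := w :* (a :+ b) :+ (X :+ Y)) refl
               w (cim D IJ Aᵢⱼ′) (cim D IJ Aⱼₖ′) (combo IJ L Aᵢⱼ′) (combo IJ L Aⱼₖ′) ⟩
    w * (cim D IJ Aᵢⱼ′ + cim D IJ Aⱼₖ′) + (combo IJ L Aᵢⱼ′ + combo IJ L Aⱼₖ′)
      ≡⟨ cong₂ _+_ (trans (cong (w *_) (cim-ij+cim-kj adm)) (*-identityʳ w)) (combo-ij+combo-kj as) ⟩
    w + sumW L ∎
    where
    open ≡-Reasoning
    open +-*-Solver

  Keep : AugSet n → Set
  Keep A = (A ≢ Aᵢⱼₖ) × (A ≢ Aᵢⱼₖ′)

  ≢-by-member : ∀ {A B : AugSet n} a → a ∈A A → ¬ a ∈A B → A ≢ B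
  ≢-by-member a a∈A a∉B refl = a∉B a∈A

  Keep-if-not-Triple : ∀ {A} → (inj₁ i ∈A A → inj₁ j ∈A A → inj₁ k ∈A A → ⊥) → Keep A
  Keep-if-not-Triple {A} ¬ijk = ¬Triple , ¬Triple
    where
    ¬Triple : ∀ {Y} → A ≢ (Triple , Y)
    ¬Triple refl = ¬ijk i∈Triple j∈Triple k∈Triple

  Keep-ij : Keep Aᵢⱼ′
  Keep-ij = ≢-by-member (inj₂ j) (PrimedEdge.j′∈A PrimedEdge-ij) ∉⊥ ,
            (≢-by-member (inj₁ k) k∈Triple (¬k∈ ∘ ∈-fromList⁻ (i ∷ j ∷ [])) ∘ sym)
    where
    ¬k∈ : ¬ Any (k ≡_) (i ∷ j ∷ [])
    ¬k∈ (here k≡i)         = i≢k (sym k≡i)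
    ¬k∈ (there (here k≡j)) = k≢j k≡j

  Keep-kj : Keep Aⱼₖ′
  Keep-kj = ≢-by-member (inj₂ j) (PrimedEdge.j′∈A PrimedEdge-kj) ∉⊥ ,
            (≢-by-member (inj₁ i) i∈Triple (¬i∈ ∘ ∈-fromList⁻ (j ∷ k ∷ [])) ∘ sym)
    where
    ¬i∈ : ¬ Any (i ≡_) (j ∷ k ∷ [])
    ¬i∈ (here i≡j)         = i≢j i≡j
    ¬i∈ (there (here i≡k)) = i≢k i≡k

  Pⁱ-stars-kept : ∀ A → IsStar Adjⁱ Pⁱ.IJᵖ A → Keep A
  Pⁱ-stars-kept A S = Keep-if-not-Triple λ i∈ j∈ k∈ → Pⁱ.Star.misses-s-j-f S i∈ j∈ k∈

  Pᵏ-stars-kept : ∀ A → IsStar Adjᵏ Pᵏ.IJᵖ A → Keep A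
  Pᵏ-stars-kept A S = Keep-if-not-Triple λ i∈ j∈ k∈ → Pᵏ.Star.misses-s-j-f S k∈ j∈ i∈

  to-parts : ∀ {x} → InCIMon Adj I J Keep x →
             InCIM Adjⁱ Pⁱ.Iᵖ Pⁱ.Jᵖ x × InCIM Adjᵏ Pᵏ.Iᵖ Pᵏ.Jᵖ x × x Aᵢⱼ′ + x Aⱼₖ′ ≡ 1ℚ
  to-parts {x} x∈@(L , adm , total , agrees) =
    Pⁱ.project x∈ Pⁱ-stars-kept , Pᵏ.project x∈ Pᵏ-stars-kept ,
    (begin
      x Aᵢⱼ′ + x Aⱼₖ′
        ≡⟨ cong₂ _+_ (agrees Aᵢⱼ′ (Pⁱ.star-lift _ (Pⁱ.PrimedEdge⇒star PrimedEdge-ij)) Keep-ij)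
                     (agrees Aⱼₖ′ (Pᵏ.star-lift _ (Pᵏ.PrimedEdge⇒star PrimedEdge-kj)) Keep-kj) ⟩
      combo IJ L Aᵢⱼ′ + combo IJ L Aⱼₖ′ ≡⟨ combo-ij+combo-kj adm ⟩
      sumW L                            ≡⟨ total ⟩
      1ℚ ∎)
    where open ≡-Reasoning

  IJ⊆U : IJ ⊆ U
  IJ⊆U m with x∈p∪q⁻ I J m
  ... | inj₁ v∈I = I⊆U v∈I
  ... | inj₂ v∈J = J⊆U v∈J

  Adjⁱ-at : ∀ {c x} → c ∈ Uⁱ → c ≢ j → Adj c x ≡ true → Adjⁱ c x ≡ true
  Adjⁱ-at {c} {x} c∈Uⁱ c≢j cx = restrict-intro Cⁱ Uⁱ Cⁱ-cx c∈Uⁱ (Uⁱ-closed c∈Uⁱ Cⁱ-cx)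
    where
    Cⁱ-cx : Cⁱ c x ≡ true
    Cⁱ-cx = trans (cut-keeps Adj j k λ { (inj₁ (c≡j , _)) → c≢j c≡j ; (inj₂ (refl , _)) → k∉Uⁱ c∈Uⁱ }) cx

  Adjᵏ-at : ∀ {c x} → c ∉ Uⁱ → Adj c x ≡ true → Adjᵏ c x ≡ true
  Adjᵏ-at {c} {x} c∉Uⁱ cx = restrict-intro Cᵏ Uᵏ Cᵏ-cx c∈Uᵏ (Uᵏ-closed c∈Uᵏ Cᵏ-cx)
    where
    c∈Uᵏ : c ∈ Uᵏ
    c∈Uᵏ = ∉Uⁱ⇒∈Uᵏ (proj₁ (inside _ _ cx)) c∉Uⁱ
    Cᵏ-cx : Cᵏ c x ≡ true
    Cᵏ-cx = trans (cut-keeps Adj i j λ { (inj₁ (refl , _)) → c∉Uⁱ i∈Uⁱ ; (inj₂ (refl , _)) → c∉Uⁱ j∈Uⁱ }) cx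

  j-star-old-part : ∀ {A} → (∀ w → w ∈A A → w ≢ inj₁ j → AugAdj Adj IJ (inj₁ j) w) →
    inj₁ i ∈A A → inj₁ j ∈A A → inj₁ k ∈A A → proj₁ A ≡ Triple
  j-star-old-part {A} spoke i∈A j∈A k∈A = ⊆-antisym ⊆Triple Triple⊆
    where
    ⊆Triple : proj₁ A ⊆ Triple
    ⊆Triple {v} v∈A with v ≟ j
    ... | yes refl = j∈Triple
    ... | no v≢j with neighbours-of-j (spoke (inj₁ v) v∈A λ { refl → v≢j refl })
    ...   | inj₁ refl = i∈Triple
    ...   | inj₂ refl = k∈Triple
    Triple⊆ : Triple ⊆ proj₁ A
    Triple⊆ v∈ with ∈-fromList⁻ (i ∷ j ∷ k ∷ []) v∈
    ... | here refl                 = i∈A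
    ... | there (here refl)         = j∈A
    ... | there (there (here refl)) = k∈A

  j-star-primed≡j : ∀ {A} → (∀ w → w ∈A A → w ≢ inj₁ j → AugAdj Adj IJ (inj₁ j) w) →
    ∀ {v} → v ∈ proj₂ A → v ≡ j
  j-star-primed≡j spoke v′∈A = sym (proj₁ (spoke (inj₂ _) v′∈A (λ ())))

  j-star-primed-part : ∀ {A} → (∀ w → w ∈A A → w ≢ inj₁ j → AugAdj Adj IJ (inj₁ j) w) →
    proj₂ A ≡ Subset.⊥ ⊎ proj₂ A ≡ fromList (j ∷ [])
  j-star-primed-part {A} spoke with j ∈? proj₂ A
  ... | no j′∉A  = inj₁ (⊆-antisym
    (λ v′∈A → contradiction (subst (_∈ proj₂ A) (j-star-primed≡j spoke v′∈A) v′∈A) j′∉A)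
    (λ m → contradiction m ∉⊥))
  ... | yes j′∈A = inj₂ (⊆-antisym
    (λ v′∈A → subst (_∈ fromList (j ∷ [])) (sym (j-star-primed≡j spoke v′∈A)) (x∈p∪q⁺ (inj₁ (x∈⁅x⁆ j))))
    (λ m → subst (_∈ proj₂ A) (sym (singleton⁻ (∈-fromList⁻ (j ∷ []) m))) j′∈A))

  star-split : ∀ A → IsStar Adj IJ A → Keep A → IsStar Adjⁱ Pⁱ.IJᵖ A ⊎ IsStar Adjᵏ Pᵏ.IJᵖ A
  star-split A (inj₂ v , v′∈A , spoke , size) _ with v ∈? Uⁱ
  ... | yes v∈Uⁱ = inj₁ (Pⁱ.star-at-primed v′∈A spoke size λ _ → v∈Uⁱ)
  ... | no  v∉Uⁱ = inj₂ (Pᵏ.star-at-primed v′∈A spoke size λ v∈IJ → ∉Uⁱ⇒∈Uᵏ (IJ⊆U v∈IJ) v∉Uⁱ)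
  star-split A (inj₁ c , c∈A , spoke , size) keep with c ≟ j | c ∈? Uⁱ
  ... | no c≢j | yes c∈Uⁱ = inj₁ (Pⁱ.star-at-old c∈A spoke size (λ _ → Adjⁱ-at c∈Uⁱ c≢j) λ _ → c∈Uⁱ)
  ... | no c≢j | no  c∉Uⁱ =
    inj₂ (Pᵏ.star-at-old c∈A spoke size (λ _ → Adjᵏ-at c∉Uⁱ) λ c∈IJ → ∉Uⁱ⇒∈Uᵏ (IJ⊆U c∈IJ) c∉Uⁱ)
  ... | yes refl | _ with k ∈? proj₁ A | i ∈? proj₁ A
  ...   | no k∉A | _ = inj₁ (Pⁱ.star-at-old c∈A spoke size only-i λ _ → j∈Uⁱ)
    where
    only-i : ∀ {x} → inj₁ x ∈A A → Adj j x ≡ true → Adjⁱ j x ≡ true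
    only-i x∈A jx with neighbours-of-j jx
    ... | inj₁ refl = restrict-intro Cⁱ Uⁱ Cⁱ-ji j∈Uⁱ i∈Uⁱ
    ... | inj₂ refl = contradiction x∈A k∉A
  ...   | yes _ | no i∉A = inj₂ (Pᵏ.star-at-old c∈A spoke size only-k λ _ → j∈Uᵏ)
    where
    only-k : ∀ {x} → inj₁ x ∈A A → Adj j x ≡ true → Adjᵏ j x ≡ true
    only-k x∈A jx with neighbours-of-j jx
    ... | inj₁ refl = contradiction x∈A i∉A
    ... | inj₂ refl = restrict-intro Cᵏ Uᵏ Cᵏ-jk j∈Uᵏ k∈Uᵏ
  ...   | yes k∈A | yes i∈A with j-star-primed-part {A} spoke
  ...     | inj₁ no-j′ = contradiction (cong₂ _,_ (j-star-old-part spoke i∈A c∈A k∈A) no-j′) (proj₁ keep)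
  ...     | inj₂ j′  = contradiction (cong₂ _,_ (j-star-old-part spoke i∈A c∈A k∈A) j′) (proj₂ keep)

  Adjⁱ-ij : Adjⁱ i j ≡ true
  Adjⁱ-ij = restrict-intro Cⁱ Uⁱ Cⁱ-ij i∈Uⁱ j∈Uⁱ

  Adjᵏ-jk : Adjᵏ j k ≡ true
  Adjᵏ-jk = restrict-intro Cᵏ Uᵏ Cᵏ-jk j∈Uᵏ k∈Uᵏ

  glue : Adjacency n → Adjacency n → Adjacency n
  glue D₁ D₂ u v = if Adjⁱ u v then D₁ u v else D₂ u v

  glue-ⁱ : ∀ {D₁ D₂ u v} → Adjⁱ u v ≡ true → glue D₁ D₂ u v ≡ D₁ u v
  glue-ⁱ e rewrite e = refl

  glue-ᵏ : ∀ {D₁ D₂ u v} → Adjⁱ u v ≡ false → glue D₁ D₂ u v ≡ D₂ u v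
  glue-ᵏ e rewrite e = refl

  Adjⁱ-false-sym : ∀ {u v} → Adjⁱ u v ≡ false → Adjⁱ v u ≡ false
  Adjⁱ-false-sym {u} {v} e = ¬-not λ vu → true≢false (trans (sym (Pⁱ.Adjᵖ-sym v u vu)) e)

  Adjⁱ-outside : ∀ {u v} → u ∉ Uⁱ → Adjⁱ u v ≡ false
  Adjⁱ-outside {u} {v} u∉Uⁱ = ¬-not λ uv → u∉Uⁱ (proj₁ (Pⁱ.Adjᵖ-inside u v uv))

  module Glued {D₁ D₂ : Adjacency n} (adm₁ : IsAdmissibleDAG Adjⁱ Pⁱ.Jᵖ D₁)
               (adm₂ : IsAdmissibleDAG Adjᵏ Pᵏ.Jᵖ D₂) (agree-at-j : D₁ i j ≡ D₂ j k) where

    module A₁ = IsAdmissibleDAG adm₁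
    module A₂ = IsAdmissibleDAG adm₂

    G : Adjacency n
    G = glue D₁ D₂

    G-ⁱ : ∀ {u v} → Adjⁱ u v ≡ true → G u v ≡ D₁ u v
    G-ⁱ = glue-ⁱ {D₁} {D₂}

    G-ᵏ : ∀ {u v} → Adjⁱ u v ≡ false → G u v ≡ D₂ u v
    G-ᵏ = glue-ᵏ {D₁} {D₂}

    G⊆Adj : ∀ u v → G u v ≡ true → Adj u v ≡ true
    G⊆Adj u v Guv with Adjⁱ u v Bool.≟ true
    ... | yes uvⁱ = Pⁱ.Adjᵖ⊆Adj u v (A₁.arcs-edges u v (trans (sym (G-ⁱ uvⁱ)) Guv))
    ... | no ¬uvⁱ = Pᵏ.Adjᵖ⊆Adj u v (A₂.arcs-edges u v (trans (sym (G-ᵏ (¬-not ¬uvⁱ))) Guv))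

    G-edges-arcs : ∀ u v → Adj u v ≡ true → G u v ≡ true ⊎ G v u ≡ true
    G-edges-arcs u v uv with Adjⁱ u v Bool.≟ true
    ... | yes uvⁱ = Sum.map (trans (G-ⁱ uvⁱ)) (trans (G-ⁱ (Pⁱ.Adjᵖ-sym u v uvⁱ))) (A₁.edges-arcs u v uvⁱ)
    ... | no ¬uvⁱ with Adjⁱ∪Adjᵏ u v uv
    ...   | inj₁ uvⁱ = contradiction uvⁱ ¬uvⁱ
    ...   | inj₂ uvᵏ = Sum.map (trans (G-ᵏ (¬-not ¬uvⁱ))) (trans (G-ᵏ (Adjⁱ-false-sym (¬-not ¬uvⁱ))))
                               (A₂.edges-arcs u v uvᵏ)

    G-antisym : ∀ u v → G u v ≡ true → G v u ≡ false
    G-antisym u v Guv with Adjⁱ u v Bool.≟ true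
    ... | yes uvⁱ = trans (G-ⁱ (Pⁱ.Adjᵖ-sym u v uvⁱ)) (A₁.antisym u v (trans (sym (G-ⁱ uvⁱ)) Guv))
    ... | no ¬uvⁱ = trans (G-ᵏ (Adjⁱ-false-sym (¬-not ¬uvⁱ)))
                          (A₂.antisym u v (trans (sym (G-ᵏ (¬-not ¬uvⁱ))) Guv))

    G-chain-at-j : Chain G i j k
    G-chain-at-j with D₁ i j Bool.≟ true
    ... | yes i→j = inj₁ (trans (G-ⁱ Adjⁱ-ij) i→j ,
                          trans (G-ᵏ (Adjⁱ-false-sym (Adjⁱ-outside k∉Uⁱ))) (trans (sym agree-at-j) i→j))
    ... | no ¬i→j =
      inj₂ (trans (G-ⁱ (Pⁱ.Adjᵖ-sym i j Adjⁱ-ij)) (trans (reverse-arc adm₁ Adjⁱ-ij) (cong not i↛j)) ,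
            trans (G-ᵏ (Adjⁱ-outside k∉Uⁱ)) (trans (reverse-arc adm₂ Adjᵏ-jk) (cong not j↛k)))
      where
      i↛j : D₁ i j ≡ false
      i↛j = ¬-not ¬i→j
      j↛k : D₂ j k ≡ false
      j↛k = trans (sym agree-at-j) i↛j

    G-J-chain : ∀ j′ i′ k′ → j′ ∈ J → i′ ≢ k′ → Adj i′ j′ ≡ true → Adj k′ j′ ≡ true → Chain G i′ j′ k′
    G-J-chain j′ i′ k′ j′∈J i′≢k′ i′j′ k′j′ with j ≟ j′
    ... | yes refl with neighbours-of-j (adj-sym i′j′) | neighbours-of-j (adj-sym k′j′)
    ...   | inj₁ refl | inj₁ refl = contradiction refl i′≢k′
    ...   | inj₂ refl | inj₂ refl = contradiction refl i′≢k′
    ...   | inj₁ refl | inj₂ refl = G-chain-at-j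
    ...   | inj₂ refl | inj₁ refl = Chain-swap {D = G} G-chain-at-j
    G-J-chain j′ i′ k′ j′∈J i′≢k′ i′j′ k′j′ | no j≢j′ with j′ ∈? Uⁱ
    ... | yes j′∈Uⁱ = Chain-transport {D = D₁} {D′ = G} (same i′j′ⁱ) (same j′k′ⁱ) (same j′i′ⁱ) (same k′j′ⁱ)
                        (A₁.J-chain j′ i′ k′ (Pⁱ.J∖j∩W⊆Jᵖ j′∈J (j≢j′ ∘ sym) j′∈Uⁱ) i′≢k′ i′j′ⁱ k′j′ⁱ)
      where
      same : ∀ {u v} → Adjⁱ u v ≡ true → D₁ u v ≡ G u v
      same uv = sym (G-ⁱ uv)
      j′i′ⁱ : Adjⁱ j′ i′ ≡ true
      j′i′ⁱ = Adjⁱ-at j′∈Uⁱ (j≢j′ ∘ sym) (adj-sym i′j′)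
      j′k′ⁱ : Adjⁱ j′ k′ ≡ true
      j′k′ⁱ = Adjⁱ-at j′∈Uⁱ (j≢j′ ∘ sym) (adj-sym k′j′)
      i′j′ⁱ : Adjⁱ i′ j′ ≡ true
      i′j′ⁱ = Pⁱ.Adjᵖ-sym j′ i′ j′i′ⁱ
      k′j′ⁱ : Adjⁱ k′ j′ ≡ true
      k′j′ⁱ = Pⁱ.Adjᵖ-sym j′ k′ j′k′ⁱ
    ... | no j′∉Uⁱ = Chain-transport {D = D₂} {D′ = G} (into i′) (out-of k′) (out-of i′) (into k′)
                        (A₂.J-chain j′ i′ k′ (Pᵏ.J∖j∩W⊆Jᵖ j′∈J (j≢j′ ∘ sym) j′∈Uᵏ) i′≢k′
                                    (Pᵏ.Adjᵖ-sym j′ i′ (Adjᵏ-at j′∉Uⁱ (adj-sym i′j′)))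
                                    (Pᵏ.Adjᵖ-sym j′ k′ (Adjᵏ-at j′∉Uⁱ (adj-sym k′j′))))
      where
      j′∈Uᵏ : j′ ∈ Uᵏ
      j′∈Uᵏ = ∉Uⁱ⇒∈Uᵏ (proj₂ (inside i′ j′ i′j′)) j′∉Uⁱ
      out-of : ∀ v → D₂ j′ v ≡ G j′ v
      out-of v = sym (G-ᵏ (Adjⁱ-outside j′∉Uⁱ))
      into : ∀ u → D₂ u j′ ≡ G u j′
      into u = sym (G-ᵏ (Adjⁱ-false-sym (Adjⁱ-outside j′∉Uⁱ)))

    admissible : IsAdmissibleDAG Adj J G
    admissible = record
      { arcs-edges = G⊆Adj
      ; edges-arcs = G-edges-arcs
      ; antisym    = G-antisym
      ; acyclic    = orientation-acyclic G⊆Adj G-antisym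
      ; J-chain    = G-J-chain
      }

    cim-Gⁱ : ∀ A → IsStar Adjⁱ Pⁱ.IJᵖ A → cim G IJ A ≡ cim D₁ Pⁱ.IJᵖ A
    cim-Gⁱ A S = cim-cong G IJ A {D₁} {Pⁱ.IJᵖ}
      (Pⁱ.cB-agree G D₁ G⊆Adj (λ u v d → Pⁱ.Adjᵖ⊆Adj u v (A₁.arcs-edges u v d)) (λ u v → G-ⁱ) A S)

    cim-Gᵏ : ∀ A → IsStar Adjᵏ Pᵏ.IJᵖ A → cim G IJ A ≡ cim D₂ Pᵏ.IJᵖ A
    cim-Gᵏ A S = cim-cong G IJ A {D₂} {Pᵏ.IJᵖ}
      (Pᵏ.cB-agree G D₂ G⊆Adj (λ u v d → Pᵏ.Adjᵖ⊆Adj u v (A₂.arcs-edges u v d))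
                   (λ u v uvᵏ → G-ᵏ (¬-not λ uvⁱ → Adjⁱ∩Adjᵏ u v uvⁱ uvᵏ)) A S)

  module FromParts {x : AugSet n → ℚ} {L₁ L₂ : Weights (Adjacency n)}
    (adm₁ : AdmissibleWeights Adjⁱ Pⁱ.Jᵖ L₁) (total₁ : sumW L₁ ≡ 1ℚ)
    (agrees₁ : ∀ A → IsStar Adjⁱ Pⁱ.IJᵖ A → ⊤ → x A ≡ combo Pⁱ.IJᵖ L₁ A)
    (adm₂ : AdmissibleWeights Adjᵏ Pᵏ.Jᵖ L₂) (total₂ : sumW L₂ ≡ 1ℚ)
    (agrees₂ : ∀ A → IsStar Adjᵏ Pᵏ.IJᵖ A → ⊤ → x A ≡ combo Pᵏ.IJᵖ L₂ A)
    (hyperplane : x Aᵢⱼ′ + x Aⱼₖ′ ≡ 1ℚ) where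

    open ≡-Reasoning

    β₁ β₂ : Adjacency n → Bool
    β₁ D = D i j
    β₂ D = D j k

    mass₁-true : mass β₁ L₁ true ≡ x Aᵢⱼ′
    mass₁-true = sym (trans (agrees₁ Aᵢⱼ′ (Pⁱ.PrimedEdge⇒star PrimedEdge-ij) tt)
                            (combo-PrimedEdge Pⁱ.IJᵖ L₁ i≢j Pⁱ.j∈IJᵖ PrimedEdge-ij))

    mass₂-false : mass β₂ L₂ false ≡ x Aⱼₖ′
    mass₂-false = sym (begin
      x Aⱼₖ′                   ≡⟨ agrees₂ Aⱼₖ′ (Pᵏ.PrimedEdge⇒star PrimedEdge-kj) tt ⟩
      combo Pᵏ.IJᵖ L₂ Aⱼₖ′     ≡⟨ combo-PrimedEdge Pᵏ.IJᵖ L₂ k≢j Pᵏ.j∈IJᵖ PrimedEdge-kj ⟩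
      mass (λ D → D k j) L₂ true ≡⟨ sumBy-cong (All.map (λ {e} (_ , a) → k→j-weight e a) adm₂) ⟩
      mass β₂ L₂ false         ∎)
      where
      k→j-weight : ∀ e → IsAdmissibleDAG Adjᵏ Pᵏ.Jᵖ (proj₂ e) →
        when ⌊ proj₂ e k j Bool.≟ true ⌋ (proj₁ e) ≡ when ⌊ proj₂ e j k Bool.≟ false ⌋ (proj₁ e)
      k→j-weight (w , D) a rewrite reverse-arc a Adjᵏ-jk = cong (λ c → when c w) (≟ᵇ-not (D j k))

    total₁′ : mass β₁ L₁ true + mass β₁ L₁ false ≡ 1ℚ
    total₁′ = trans (mass-true+false β₁ L₁) (trans (sym (sumW≡sumBy L₁)) total₁)

    total₂′ : mass β₂ L₂ true + mass β₂ L₂ false ≡ 1ℚ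
    total₂′ = trans (mass-true+false β₂ L₂) (trans (sym (sumW≡sumBy L₂)) total₂)

    cross : mass β₁ L₁ true + mass β₂ L₂ false ≡ 1ℚ
    cross = trans (cong₂ _+_ mass₁-true mass₂-false) hyperplane

    same-mass : ∀ b → mass β₁ L₁ b ≡ mass β₂ L₂ b
    same-mass true  = +-cancelʳ (mass β₂ L₂ false) _ _ (trans cross (sym total₂′))
    same-mass false = +-cancelˡ (mass β₁ L₁ true) _ _ (trans total₁′ (sym cross))

    module C = Coupling β₁ β₂ L₁ L₂ (All.map proj₁ adm₁) (All.map proj₁ adm₂) same-mass

    entries : All (λ e → 0ℚ ≤ℚ proj₁ e × IsAdmissibleDAG Adjⁱ Pⁱ.Jᵖ (proj₁ (proj₂ e))
                       × IsAdmissibleDAG Adjᵏ Pᵏ.Jᵖ (proj₂ (proj₂ e))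
                       × C.compatible (proj₁ (proj₂ e)) (proj₂ (proj₂ e)) ≡ true) C.coupling
    entries = C.coupling-All (All.map proj₂ adm₁) (All.map proj₂ adm₂)

    glueEntry : ℚ × (Adjacency n × Adjacency n) → ℚ × Adjacency n
    glueEntry e = proj₁ e , glue (proj₁ (proj₂ e)) (proj₂ (proj₂ e))

    glued : Weights (Adjacency n)
    glued = Data.List.map glueEntry C.coupling

    glued-admissible : AdmissibleWeights Adj J glued
    glued-admissible = map⁺ (All.map (λ (0≤w , a₁ , a₂ , c) → 0≤w , Glued.admissible a₁ a₂ (≟ᵇ⇒≡ c)) entries)

    glued-total : sumW glued ≡ 1ℚ
    glued-total = begin
      sumW glued                      ≡⟨ sumW≡sumBy glued ⟩
      sumBy proj₁ glued               ≡⟨ sumBy-map proj₁ glueEntry C.coupling ⟩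
      sumBy proj₁ C.coupling          ≡⟨ C.total-weight ⟩
      sumBy proj₁ L₁                  ≡⟨ sym (sumW≡sumBy L₁) ⟩
      sumW L₁                         ≡⟨ total₁ ⟩
      1ℚ                              ∎

    combo-glued : ∀ A (h : Adjacency n × Adjacency n → ℚ) →
      All (λ e → cim (proj₂ (glueEntry e)) IJ A ≡ h (proj₂ e)) C.coupling →
      combo IJ glued A ≡ sumBy (λ e → proj₁ e * h (proj₂ e)) C.coupling
    combo-glued A h same = begin
      combo IJ glued A                                             ≡⟨ combo≡sumBy IJ glued A ⟩
      sumBy (λ e → proj₁ e * cim (proj₂ e) IJ A) glued             ≡⟨ sumBy-map _ glueEntry C.coupling ⟩
      sumBy (λ e → proj₁ e * cim (proj₂ (glueEntry e)) IJ A) C.coupling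
        ≡⟨ sumBy-cong (All.map (λ {e} → cong (proj₁ e *_)) same) ⟩
      sumBy (λ e → proj₁ e * h (proj₂ e)) C.coupling               ∎

    glued-agrees : ∀ A → IsStar Adj IJ A → Keep A → x A ≡ combo IJ glued A
    glued-agrees A S keep with star-split A S keep
    ... | inj₁ Sⁱ = begin
      x A                                                   ≡⟨ agrees₁ A Sⁱ tt ⟩
      combo Pⁱ.IJᵖ L₁ A                                     ≡⟨ combo≡sumBy Pⁱ.IJᵖ L₁ A ⟩
      sumBy (λ e → proj₁ e * cim (proj₂ e) Pⁱ.IJᵖ A) L₁     ≡⟨ sym (C.marginal₁ (λ D → cim D Pⁱ.IJᵖ A)) ⟩
      sumBy (λ e → proj₁ e * cim (proj₁ (proj₂ e)) Pⁱ.IJᵖ A) C.coupling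
        ≡⟨ sym (combo-glued A (λ p → cim (proj₁ p) Pⁱ.IJᵖ A)
                 (All.map (λ (_ , a₁ , a₂ , c) → Glued.cim-Gⁱ a₁ a₂ (≟ᵇ⇒≡ c) A Sⁱ) entries)) ⟩
      combo IJ glued A                                      ∎
    ... | inj₂ Sᵏ = begin
      x A                                                   ≡⟨ agrees₂ A Sᵏ tt ⟩
      combo Pᵏ.IJᵖ L₂ A                                     ≡⟨ combo≡sumBy Pᵏ.IJᵖ L₂ A ⟩
      sumBy (λ e → proj₁ e * cim (proj₂ e) Pᵏ.IJᵖ A) L₂     ≡⟨ sym (C.marginal₂ (λ D → cim D Pᵏ.IJᵖ A)) ⟩
      sumBy (λ e → proj₁ e * cim (proj₂ (proj₂ e)) Pᵏ.IJᵖ A) C.coupling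
        ≡⟨ sym (combo-glued A (λ p → cim (proj₂ p) Pᵏ.IJᵖ A)
                 (All.map (λ (_ , a₁ , a₂ , c) → Glued.cim-Gᵏ a₁ a₂ (≟ᵇ⇒≡ c) A Sᵏ) entries)) ⟩
      combo IJ glued A                                      ∎

  from-parts : ∀ {x} → InCIM Adjⁱ Pⁱ.Iᵖ Pⁱ.Jᵖ x → InCIM Adjᵏ Pᵏ.Iᵖ Pᵏ.Jᵖ x → x Aᵢⱼ′ + x Aⱼₖ′ ≡ 1ℚ →
               InCIMon Adj I J Keep x
  from-parts (_ , adm₁ , total₁ , agrees₁) (_ , adm₂ , total₂ , agrees₂) hyperplane =
    glued , glued-admissible , glued-total , glued-agrees
    where open FromParts adm₁ total₁ agrees₁ adm₂ total₂ agrees₂ hyperplane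

corollary6p10 :
  (n : ℕ) (U : Subset n) (Adj : Adjacency n) (I J : Subset n) →
  IsGluingTree U Adj I J →
  (j i k : Fin n) → j ∈ J → i ≢ k → Adj i j ≡ true → Adj k j ≡ true →
  (Uⁱ Uᵏ : Subset n) →
  (∀ v → (v ∈ Uⁱ) ⇔ Reach (cut Adj j k) i v) →
  (∀ v → (v ∈ Uᵏ) ⇔ Reach (cut Adj i j) k v) →
  ((x : AugSet n → ℚ) → InCIM Adj I J x →
    (x (setA (i ∷ j ∷ k ∷ []) []) ≡ 0ℚ)
    × (x (setA (i ∷ j ∷ k ∷ []) (j ∷ [])) ≡ 0ℚ))
  × ((x : AugSet n → ℚ) →
    InCIMon Adj I J
      (λ A → (A ≢ setA (i ∷ j ∷ k ∷ []) []) × (A ≢ setA (i ∷ j ∷ k ∷ []) (j ∷ []))) x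
    ⇔ (InCIM (restrict (cut Adj j k) Uⁱ) (partI I j Uⁱ) (partJ J j Uⁱ) x
       × InCIM (restrict (cut Adj i j) Uᵏ) (partI I j Uᵏ) (partJ J j Uᵏ) x
       × (x (setA (i ∷ j ∷ []) (j ∷ [])) + x (setA (j ∷ k ∷ []) (j ∷ [])) ≡ 1ℚ)))
corollary6p10 n U Adj I J GT j i k j∈J i≢k ij kj Uⁱ Uᵏ Uⁱ-spec Uᵏ-spec =
  (λ x → triple-coordinates-vanish) ,
  (λ x → mk⇔ to-parts λ (x∈ⁱ , x∈ᵏ , hyperplane) → from-parts x∈ⁱ x∈ᵏ hyperplane)
  where open Parting GT j i k j∈J i≢k ij kj Uⁱ Uᵏ Uⁱ-spec Uᵏ-spec
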